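{- Let $G=(V,E)$ be a finite simple graph on $d$ vertices. For each acyclic orientation $\rho$ of $G$ fix a natural labeling of $\Pi_\rho$. Then the leading coefficient of the polynomial $\widetilde\chi^{\mathbf 1}_G(q,x)\in\mathbb{Q}(q)[x]$ equals \[ \frac{1}{[d]_q!} \sum_{\rho\in \mathcal{A}(G)} \ \sum_{\sigma\in \mathcal{L}(\Pi_\rho)} q^{d+\operatorname{maj}{\sigma}} . \]
   Context: $\chi^{\mathbf 1}_G(q,n):=\sum_c q^{\sum_{v}c(v)}$ over proper colorings $c:V\to\{1,\dots,n\}$; $\widetilde\chi^{\mathbf 1}_G(q,x)$ is the unique polynomial in $\mathbb{Q}(q)[x]$ with $\widetilde\chi^{\mathbf 1}_G(q,[n]_q)=\chi^{\mathbf 1}_G(q,n)$ for all positive integers $n$, where $[n]_q=\frac{1-q^n}{1-q}$; $[d]_q!=[1]_q[2]_q\cdots[d]_q$. $\mathcal{A}(G)$ is the set of acyclic orientations of $G$; $\Pi_\rho$ is the poset on $V$ with $u\preceq w$ iff there is a directed path (possibly of length 0) from $u$ to $w$ in $\rho$. A natural labeling of a $d$-element poset $\Pi$ is a bijection $\omega:\Pi\to[d]$ with $\omega(x)<\omega(y)$ whenever $x\prec y$; a linear extension $y_1,\dots,y_d$ of $\Pi$ (a listing with $y_i\prec y_j\Rightarrow i<j$) is identified with the permutation $\sigma=(\omega(y_1),\dots,\omega(y_d))$, and $\mathcal{L}(\Pi)$ is the set of these permutations. $\operatorname{Des}(\sigma)=\{j\in[d-1]:\sigma(j+1)<\sigma(j)\}$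 and $\operatorname{maj}(\sigma)=\sum_{j\in\operatorname{Des}(\sigma)} j$. -}

module Defs where

open import Data.Bool using (Bool; true; false; not; _∧_; _∨_; _xor_; if_then_else_; T)
open import Data.Nat using (ℕ; zero; suc; _+_; _<_; _<ᵇ_; _≤_)
open import Data.Integer as ℤ using (ℤ; +_)
open import Data.Fin using (Fin; toℕ; _≟_)
open import Data.Bool.ListAction using (any; all)
open import Data.Nat.ListAction using (sum)
open import Data.List as List using (List; []; _∷_; map; concatMap; foldr; allFin; upTo; replicate; _++_; length)
open import Data.Vec.Functional using (Vector) renaming (_∷_ to _∷ᶠ_)
open import Data.Product using (Σ; ∃; _×_; _,_)
open import Relation.Nullary using (¬_)
open import Relation.Nullary.Decidable using (⌊_⌋)
open import Relation.Binary.PropositionalEquality using (_≡_)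
open import Function.Definitions using (Injective)

-- Polynomials in q with integer coefficients (lowest degree first)

Poly : Set
Poly = List ℤ

infixl 6 _+ₚ_
infixl 7 _*ₚ_

_+ₚ_ : Poly → Poly → Poly
[] +ₚ r = r
(a ∷ p) +ₚ [] = a ∷ p
(a ∷ p) +ₚ (b ∷ r) = (a ℤ.+ b) ∷ (p +ₚ r)

scaleₚ : ℤ → Poly → Poly
scaleₚ a = map (a ℤ.*_)

_*ₚ_ : Poly → Poly → Poly
[] *ₚ r = []
(a ∷ p) *ₚ r = scaleₚ a r +ₚ (+ 0 ∷ (p *ₚ r))

coeff : Poly → ℕ → ℤ
coeff [] i = + 0
coeff (a ∷ p) zero = a
coeff (a ∷ p) (suc i) = coeff p i

-- equality of polynomials (coefficientwise; trailing zeros irrelevant)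
infix 4 _≈ₚ_
_≈ₚ_ : Poly → Poly → Set
p ≈ₚ r = ∀ i → coeff p i ≡ coeff r i

0ₚ : Poly
0ₚ = []

sumₚ : List Poly → Poly
sumₚ = foldr _+ₚ_ 0ₚ

qpow : ℕ → Poly
qpow m = replicate m (+ 0) ++ (+ 1 ∷ [])

qint : ℕ → Poly
qint n = replicate n (+ 1)

qfact : ℕ → Poly
qfact zero = + 1 ∷ []
qfact (suc d) = qfact d *ₚ qint (suc d)

-- every function Fin d → A whose values lie in the given list (each once)
allFuns : ∀ {a} {A : Set a} (d : ℕ) → List A → List (Fin d → A)
allFuns zero xs = (λ ()) ∷ []
allFuns (suc d) xs = concatMap (λ x → map (λ f → x ∷ᶠ f) (allFuns d xs)) xs

allF : ∀ {d} → (Fin d → Bool) → Bool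
allF {d} f = all f (allFin d)

anyF : ∀ {d} → (Fin d → Bool) → Bool
anyF {d} f = any f (allFin d)

_==_ : ∀ {d} → Fin d → Fin d → Bool
i == j = ⌊ i ≟ j ⌋

-- Graphs: vertex set Fin d, adjacency given by a Bool-valued relation

Rel : ℕ → Set
Rel d = Fin d → Fin d → Bool

-- proper colouring c : V → {1..n} (colour i ∈ Fin n stands for i+1)
isProper : ∀ {d n} → Rel d → (Fin d → Fin n) → Bool
isProper adj c = allF λ u → allF λ v → not (adj u v) ∨ not (c u == c v)

colourWeight : ∀ {d n} → (Fin d → Fin n) → ℕ
colourWeight {d} c = sum (map (λ v → suc (toℕ (c v))) (allFin d))

-- χ^1_G(q,n) = Σ_{proper c} q^{Σ_v c(v)}
chi : ∀ {d} → Rel d → ℕ → Poly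
chi {d} adj n =
  sumₚ (map (λ c → if isProper adj c then qpow (colourWeight c) else 0ₚ)
            (allFuns d (allFin n)))

-- Orientations (ρ u v = true means arc u → v)

isOrientation : ∀ {d} → Rel d → Rel d → Bool
isOrientation adj ρ =
  allF λ u → allF λ v → if adj u v then ρ u v xor ρ v u else not (ρ u v)

walk : ∀ {d} → ℕ → Rel d → Fin d → Fin d → Bool
walk zero ρ u v = u == v
walk (suc k) ρ u v = anyF λ w → ρ u w ∧ walk k ρ w v

-- u ⪯ v in Π_ρ: directed path (possibly of length 0) from u to v;
-- a directed path on d vertices has fewer than d arcs
reach : ∀ {d} → Rel d → Fin d → Fin d → Bool
reach {d} ρ u v = any (λ k → walk k ρ u v) (upTo d)

below : ∀ {d} → Rel d → Fin d → Fin d → Bool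
below ρ u v = reach ρ u v ∧ not (u == v)

-- no directed cycle (a directed cycle has between 1 and d arcs)
isAcyclic : ∀ {d} → Rel d → Bool
isAcyclic {d} ρ = not (anyF λ u → any (λ k → walk (suc k) ρ u u) (upTo d))

isAcyclicOrientation : ∀ {d} → Rel d → Rel d → Bool
isAcyclicOrientation adj ρ = isOrientation adj ρ ∧ isAcyclic ρ

-- Natural labelings and linear extensions
-- (labels are Fin d = {0..d-1}, standing for {1..d}; only their order matters)

IsNaturalLabeling : ∀ {d} → Rel d → (Fin d → Fin d) → Set
IsNaturalLabeling ρ ω =
  Injective _≡_ _≡_ ω × (∀ j → ∃ λ x → ω x ≡ j) ×
  (∀ x y → T (below ρ x y) → toℕ (ω x) < toℕ (ω y))

-- y : Fin d → V is a listing y_1,…,y_d of V (a bijection) with y_i ≺ y_j ⇒ i < j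
isLinearExtension : ∀ {d} → Rel d → (Fin d → Fin d) → Bool
isLinearExtension ρ y =
  (allF λ i → allF λ j → not (y i == y j) ∨ (i == j)) ∧
  (allF λ i → allF λ j → not (below ρ (y i) (y j)) ∨ (toℕ i <ᵇ toℕ j))

majFrom : ℕ → List ℕ → ℕ
majFrom j [] = 0
majFrom j (a ∷ []) = 0
majFrom j (a ∷ b ∷ w) = (if b <ᵇ a then j else 0) + majFrom (suc j) (b ∷ w)

maj : ∀ {d} → (Fin d → Fin d) → ℕ
maj {d} σ = majFrom 1 (map (λ i → toℕ (σ i)) (allFin d))

-- Σ_{ρ ∈ A(G)} Σ_{σ ∈ L(Π_ρ)} q^{d + maj σ},  σ = ω_ρ ∘ y
numerator : ∀ {d} → Rel d → (Rel d → Fin d → Fin d) → Poly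
numerator {d} adj ω =
  sumₚ (map (λ ρ → if isAcyclicOrientation adj ρ
                   then sumₚ (map (λ y → if isLinearExtension ρ y
                                         then qpow (d + maj (λ i → ω ρ (y i)))
                                         else 0ₚ)
                                  (allFuns d (allFin d)))
                   else 0ₚ)
             (allFuns d (allFuns d (true ∷ false ∷ []))))

-- Polynomials in x over Q(q): an element Σ_k (P_k / D) x^k is represented
-- by a list P of numerators (P_0, P_1, …) over a common denominator D ≠ 0.

evalX : List Poly → Poly → Poly
evalX [] x = 0ₚ
evalX (c ∷ cs) x = c +ₚ x *ₚ evalX cs x

coeffX : List Poly → ℕ → Poly
coeffX [] k = 0ₚ
coeffX (c ∷ cs) zero = c
coeffX (c ∷ cs) (suc k) = coeffX cs k

-- (P, D) represents χ̃^1_G(q,x): χ̃(q,[n]_q) = χ^1_G(q,n) for all n ≥ 1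
IsChiTilde : ∀ {d} → Rel d → List Poly → Poly → Set
IsChiTilde adj P D =
  ¬ (D ≈ₚ 0ₚ) × (∀ n → 1 ≤ n → evalX P (qint n) ≈ₚ D *ₚ chi adj n)

-- the leading coefficient of Σ_k (P_k/D) x^k equals num/den in Q(q)
-- (num/den is nonzero here, so the index k is the degree)
LeadingCoeffIs : List Poly → Poly → Poly → Poly → Set
LeadingCoeffIs P D num den =
  ∃ λ k → (coeffX P k *ₚ den ≈ₚ D *ₚ num) × (∀ j → k < j → coeffX P j ≈ₚ 0ₚ)

-- Orienting every edge towards the larger colour turns a proper colouring c into the unique
-- acyclic orientation ρ along which c strictly increases, so χ(q,n) is a sum over acyclic ρ
-- of generating functions of strictly order-preserving maps Π_ρ → [n].  Sorting the vertices
-- by colour, ties by decreasing label ω, turns such a map into a linear extension σ together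
-- with a weakly increasing f : [d] → [n] that increases strictly at the ascents of σ (the
-- fundamental lemma of P-partitions).  If σ has a ascents, at positions i₁, i₂, …, and
-- e = Σ (d − iₖ), these f are counted by q^(d + e − a·d) ∏_{i<d} ([n+i]_q − [a]_q) / [d]_q!.
-- As [n+i]_q − [a]_q = q^i [n]_q + [i]_q − [a]_q, this is a polynomial of degree d in
-- x = [n]_q with leading coefficient q^(d + e + binom(d,2) − a·d) / [d]_q! = q^(d + maj σ) / [d]_q!.
-- Summing over ρ and σ interpolates χ at every [n]_q, and a polynomial in x vanishing at all
-- [n]_q is zero (their q-degrees are unbounded), so the sum is χ̃.

module Submission where

open import Defs
open import Algebra.Bundles using (CommutativeMonoid; CommutativeRing)
open import Data.Bool using (Bool; true; false; not; _∧_; _∨_; _xor_; if_then_else_; T)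
open import Data.Integer as ℤ using (ℤ; +_) renaming (_+_ to _+ℤ_; _*_ to _*ℤ_)
import Data.Integer.Properties as ℤP
open import Data.Integer.Tactic.RingSolver using () renaming (solve-∀ to solveℤ)
open import Data.Nat.Tactic.RingSolver using () renaming (solve-∀ to solveℕ)
open import Data.Fin as Fin using (Fin; zero; suc; toℕ)
import Data.Fin.Properties as FinP
open import Data.List using (List; []; _∷_; map; length; foldr; concatMap; _++_; allFin; upTo)
open import Data.Bool.ListAction using (any)
open import Data.Nat.ListAction using (sum)
open import Data.Bool.Properties using (T-∧; T-∨; T-≡; T-not-≡)
open import Data.List.Properties using (map-tabulate; map-cong)
import Data.List.Relation.Unary.All as All
open import Data.List.Relation.Unary.All.Properties using (all⁺; all⁻)
import Data.List.Relation.Unary.Any as Any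
open import Data.List.Relation.Unary.Any.Properties using (any⁺; any⁻)
open import Data.List.Membership.Propositional using (lose)
open import Data.List.Membership.Propositional.Properties using (∈-allFin; ∈-upTo⁺)
open import Data.Maybe using (just; nothing)
open import Data.Nat as ℕ using (ℕ; zero; suc; _<ᵇ_; _≤ᵇ_)
import Data.Nat.Properties as ℕP
open import Data.Product using (Σ; _×_; _,_; proj₁; proj₂; uncurry)
open import Data.Empty using (⊥-elim)
open import Data.Sum using (_⊎_; inj₁; inj₂; [_,_]′)
open import Data.Vec.Functional using () renaming (_∷_ to _∷ᶠ_)
open import Data.Vec.Functional.Relation.Binary.Pointwise using (Pointwise)
open import Level using (Level)
open import Function using (_∘_; id; const)
open import Function.Bundles using (Equivalence)
open import Function.Definitions using (Injective)
open import Relation.Binary.Definitions using (Trichotomous; tri<; tri≈; tri>)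
open import Relation.Binary.Structures using (IsStrictTotalOrder)
open import Relation.Nullary using (¬_; does; yes; no)
open import Relation.Nullary.Decidable using (dec-true; dec-false; T?; toWitness; fromWitness)
open import Relation.Binary.PropositionalEquality using (_≡_; refl; sym; trans; cong; cong₂; subst; subst₂; module ≡-Reasoning)
  renaming (isEquivalence to ≡-isEquivalence)
import Tactic.RingSolver.Core.AlmostCommutativeRing as ACR
import Relation.Binary.Reasoning.Setoid
open import Tactic.RingSolver using (solve-∀)

module PolyRing where

  -- A record rather than Defs._≈ₚ_, so that both sides can be inferred from a proof.
  infix 4 _≋_
  record _≋_ (p r : Poly) : Set where
    constructor mk≋
    field coeff≡ : ∀ i → coeff p i ≡ coeff r i
  open _≋_ public

  negₚ : Poly → Poly
  negₚ = map (ℤ.-_)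

  1ₚ : Poly
  1ₚ = + 1 ∷ []

  ≋-refl : ∀ {p} → p ≋ p
  ≋-refl = mk≋ λ _ → refl

  ≋-sym : ∀ {p r} → p ≋ r → r ≋ p
  ≋-sym (mk≋ e) = mk≋ λ i → sym (e i)

  ≋-trans : ∀ {p r s} → p ≋ r → r ≋ s → p ≋ s
  ≋-trans (mk≋ e) (mk≋ f) = mk≋ λ i → trans (e i) (f i)

  ≋-reflexive : ∀ {p r} → p ≡ r → p ≋ r
  ≋-reflexive refl = ≋-refl

  ∷-cong : ∀ {a b p r} → a ≡ b → p ≋ r → (a ∷ p) ≋ (b ∷ r)
  ∷-cong a≡b p≋r = mk≋ λ { zero → a≡b ; (suc i) → coeff≡ p≋r i }

  ∷-≋-[] : ∀ {a p} → a ≡ + 0 → p ≋ [] → (a ∷ p) ≋ []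
  ∷-≋-[] a≡0 p≋[] = mk≋ λ { zero → a≡0 ; (suc i) → coeff≡ p≋[] i }

  coeff-+ₚ : ∀ p r i → coeff (p +ₚ r) i ≡ coeff p i +ℤ coeff r i
  coeff-+ₚ [] r i = sym (ℤP.+-identityˡ _)
  coeff-+ₚ (a ∷ p) [] i = sym (ℤP.+-identityʳ _)
  coeff-+ₚ (a ∷ p) (b ∷ r) zero = refl
  coeff-+ₚ (a ∷ p) (b ∷ r) (suc i) = coeff-+ₚ p r i

  coeff-scaleₚ : ∀ a r i → coeff (scaleₚ a r) i ≡ a *ℤ coeff r i
  coeff-scaleₚ a [] i = sym (ℤP.*-zeroʳ a)
  coeff-scaleₚ a (b ∷ r) zero = refl
  coeff-scaleₚ a (b ∷ r) (suc i) = coeff-scaleₚ a r i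

  coeff-negₚ : ∀ r i → coeff (negₚ r) i ≡ ℤ.- coeff r i
  coeff-negₚ [] i = refl
  coeff-negₚ (b ∷ r) zero = refl
  coeff-negₚ (b ∷ r) (suc i) = coeff-negₚ r i

  coeff-∷*ₚ-zero : ∀ a p r → coeff ((a ∷ p) *ₚ r) 0 ≡ a *ℤ coeff r 0
  coeff-∷*ₚ-zero a p r = trans (coeff-+ₚ (scaleₚ a r) (+ 0 ∷ (p *ₚ r)) 0)
    (trans (ℤP.+-identityʳ _) (coeff-scaleₚ a r 0))

  coeff-∷*ₚ-suc : ∀ a p r i → coeff ((a ∷ p) *ₚ r) (suc i) ≡ a *ℤ coeff r (suc i) +ℤ coeff (p *ₚ r) i
  coeff-∷*ₚ-suc a p r i = trans (coeff-+ₚ (scaleₚ a r) (+ 0 ∷ (p *ₚ r)) (suc i))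
    (cong (_+ℤ coeff (p *ₚ r) i) (coeff-scaleₚ a r (suc i)))

  +ₚ-cong : ∀ {p p′ r r′} → p ≋ p′ → r ≋ r′ → (p +ₚ r) ≋ (p′ +ₚ r′)
  +ₚ-cong {p} {p′} {r} {r′} e f = mk≋ λ i →
    trans (coeff-+ₚ p r i) (trans (cong₂ _+ℤ_ (coeff≡ e i) (coeff≡ f i)) (sym (coeff-+ₚ p′ r′ i)))

  +ₚ-assoc : ∀ p r s → ((p +ₚ r) +ₚ s) ≋ (p +ₚ (r +ₚ s))
  +ₚ-assoc p r s = mk≋ λ i → begin
    coeff ((p +ₚ r) +ₚ s) i                ≡⟨ coeff-+ₚ (p +ₚ r) s i ⟩
    coeff (p +ₚ r) i +ℤ coeff s i          ≡⟨ cong (_+ℤ coeff s i) (coeff-+ₚ p r i) ⟩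
    coeff p i +ℤ coeff r i +ℤ coeff s i    ≡⟨ ℤP.+-assoc (coeff p i) (coeff r i) (coeff s i) ⟩
    coeff p i +ℤ (coeff r i +ℤ coeff s i)  ≡⟨ cong (coeff p i +ℤ_) (coeff-+ₚ r s i) ⟨
    coeff p i +ℤ coeff (r +ₚ s) i          ≡⟨ coeff-+ₚ p (r +ₚ s) i ⟨
    coeff (p +ₚ (r +ₚ s)) i                ∎
    where open ≡-Reasoning

  +ₚ-comm : ∀ p r → (p +ₚ r) ≋ (r +ₚ p)
  +ₚ-comm p r = mk≋ λ i →
    trans (coeff-+ₚ p r i) (trans (ℤP.+-comm (coeff p i) (coeff r i)) (sym (coeff-+ₚ r p i)))

  +ₚ-identityʳ : ∀ p → (p +ₚ []) ≋ p
  +ₚ-identityʳ p = mk≋ λ i → trans (coeff-+ₚ p [] i) (ℤP.+-identityʳ _)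

  negₚ-cong : ∀ {p r} → p ≋ r → negₚ p ≋ negₚ r
  negₚ-cong {p} {r} e = mk≋ λ i →
    trans (coeff-negₚ p i) (trans (cong (ℤ.-_) (coeff≡ e i)) (sym (coeff-negₚ r i)))

  +ₚ-inverseˡ : ∀ p → (negₚ p +ₚ p) ≋ []
  +ₚ-inverseˡ p = mk≋ λ i →
    trans (coeff-+ₚ (negₚ p) p i) (trans (cong (_+ℤ coeff p i) (coeff-negₚ p i)) (ℤP.+-inverseˡ (coeff p i)))

  +ₚ-inverseʳ : ∀ p → (p +ₚ negₚ p) ≋ []
  +ₚ-inverseʳ p = ≋-trans (+ₚ-comm p (negₚ p)) (+ₚ-inverseˡ p)

  *ₚ-zeroʳ : ∀ p → (p *ₚ []) ≋ []
  *ₚ-zeroʳ [] = ≋-refl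
  *ₚ-zeroʳ (a ∷ p) = ∷-≋-[] refl (*ₚ-zeroʳ p)

  *ₚ-zeroˡ-≋ : ∀ {p} r → p ≋ [] → (p *ₚ r) ≋ []
  *ₚ-zeroˡ-≋ {[]} r e = ≋-refl
  *ₚ-zeroˡ-≋ {a ∷ p} r e = mk≋ λ
    { zero → trans (coeff-∷*ₚ-zero a p r) (trans (cong (_*ℤ coeff r 0) (coeff≡ e 0)) (ℤP.*-zeroˡ (coeff r 0)))
    ; (suc i) → trans (coeff-∷*ₚ-suc a p r i)
        (cong₂ _+ℤ_ (trans (cong (_*ℤ coeff r (suc i)) (coeff≡ e 0)) (ℤP.*-zeroˡ (coeff r (suc i))))
                    (coeff≡ (*ₚ-zeroˡ-≋ {p} r (mk≋ λ j → coeff≡ e (suc j))) i)) }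

  *ₚ-congʳ : ∀ {p p′} r → p ≋ p′ → (p *ₚ r) ≋ (p′ *ₚ r)
  *ₚ-congʳ {[]} {p′} r e = ≋-sym (*ₚ-zeroˡ-≋ r (≋-sym e))
  *ₚ-congʳ {a ∷ p} {[]} r e = *ₚ-zeroˡ-≋ r e
  *ₚ-congʳ {a ∷ p} {a′ ∷ p′} r e = mk≋ λ
    { zero → trans (coeff-∷*ₚ-zero a p r) (trans (cong (_*ℤ _) (coeff≡ e 0)) (sym (coeff-∷*ₚ-zero a′ p′ r)))
    ; (suc i) → trans (coeff-∷*ₚ-suc a p r i)
        (trans (cong₂ _+ℤ_ (cong (_*ℤ _) (coeff≡ e 0)) (coeff≡ (*ₚ-congʳ {p} {p′} r (mk≋ λ j → coeff≡ e (suc j))) i))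
               (sym (coeff-∷*ₚ-suc a′ p′ r i))) }

  *ₚ-congˡ : ∀ p {r r′} → r ≋ r′ → (p *ₚ r) ≋ (p *ₚ r′)
  *ₚ-congˡ [] e = ≋-refl
  *ₚ-congˡ (a ∷ p) {r} {r′} e = mk≋ λ
    { zero → trans (coeff-∷*ₚ-zero a p r) (trans (cong (a *ℤ_) (coeff≡ e 0)) (sym (coeff-∷*ₚ-zero a p r′)))
    ; (suc i) → trans (coeff-∷*ₚ-suc a p r i)
        (trans (cong₂ _+ℤ_ (cong (a *ℤ_) (coeff≡ e (suc i))) (coeff≡ (*ₚ-congˡ p e) i))
               (sym (coeff-∷*ₚ-suc a p r′ i))) }

  +ₚ-congˡ : ∀ p {r r′} → r ≋ r′ → (p +ₚ r) ≋ (p +ₚ r′)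
  +ₚ-congˡ p = +ₚ-cong (≋-refl {p})

  +ₚ-congʳ : ∀ {p p′} r → p ≋ p′ → (p +ₚ r) ≋ (p′ +ₚ r)
  +ₚ-congʳ r e = +ₚ-cong e (≋-refl {r})

  *ₚ-cong : ∀ {p p′ r r′} → p ≋ p′ → r ≋ r′ → (p *ₚ r) ≋ (p′ *ₚ r′)
  *ₚ-cong {p′ = p′} {r} e f = ≋-trans (*ₚ-congʳ r e) (*ₚ-congˡ p′ f)

  *ₚ-distribʳ : ∀ p r s → ((p +ₚ r) *ₚ s) ≋ ((p *ₚ s) +ₚ (r *ₚ s))
  *ₚ-distribʳ [] r s = ≋-refl
  *ₚ-distribʳ (a ∷ p) [] s = ≋-sym (+ₚ-identityʳ ((a ∷ p) *ₚ s))
  *ₚ-distribʳ (a ∷ p) (b ∷ r) s = mk≋ λ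
    { zero → begin
        coeff ((a +ℤ b ∷ p +ₚ r) *ₚ s) 0                  ≡⟨ coeff-∷*ₚ-zero (a +ℤ b) (p +ₚ r) s ⟩
        (a +ℤ b) *ℤ coeff s 0                             ≡⟨ ℤP.*-distribʳ-+ (coeff s 0) a b ⟩
        a *ℤ coeff s 0 +ℤ b *ℤ coeff s 0                  ≡⟨ cong₂ _+ℤ_ (coeff-∷*ₚ-zero a p s) (coeff-∷*ₚ-zero b r s) ⟨
        coeff ((a ∷ p) *ₚ s) 0 +ℤ coeff ((b ∷ r) *ₚ s) 0  ≡⟨ coeff-+ₚ ((a ∷ p) *ₚ s) ((b ∷ r) *ₚ s) 0 ⟨
        coeff (((a ∷ p) *ₚ s) +ₚ ((b ∷ r) *ₚ s)) 0        ∎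
    ; (suc i) → begin
        coeff ((a +ℤ b ∷ p +ₚ r) *ₚ s) (suc i)               ≡⟨ coeff-∷*ₚ-suc (a +ℤ b) (p +ₚ r) s i ⟩
        (a +ℤ b) *ℤ coeff s (suc i) +ℤ coeff ((p +ₚ r) *ₚ s) i
          ≡⟨ cong ((a +ℤ b) *ℤ coeff s (suc i) +ℤ_) (trans (coeff≡ (*ₚ-distribʳ p r s) i) (coeff-+ₚ (p *ₚ s) (r *ₚ s) i)) ⟩
        (a +ℤ b) *ℤ coeff s (suc i) +ℤ (coeff (p *ₚ s) i +ℤ coeff (r *ₚ s) i)
          ≡⟨ regroup a b (coeff s (suc i)) (coeff (p *ₚ s) i) (coeff (r *ₚ s) i) ⟩
        (a *ℤ coeff s (suc i) +ℤ coeff (p *ₚ s) i) +ℤ (b *ℤ coeff s (suc i) +ℤ coeff (r *ₚ s) i)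
          ≡⟨ cong₂ _+ℤ_ (coeff-∷*ₚ-suc a p s i) (coeff-∷*ₚ-suc b r s i) ⟨
        coeff ((a ∷ p) *ₚ s) (suc i) +ℤ coeff ((b ∷ r) *ₚ s) (suc i)
          ≡⟨ coeff-+ₚ ((a ∷ p) *ₚ s) ((b ∷ r) *ₚ s) (suc i) ⟨
        coeff (((a ∷ p) *ₚ s) +ₚ ((b ∷ r) *ₚ s)) (suc i)  ∎ }
    where
    open ≡-Reasoning
    regroup : ∀ a b x y z → (a +ℤ b) *ℤ x +ℤ (y +ℤ z) ≡ (a *ℤ x +ℤ y) +ℤ (b *ℤ x +ℤ z)
    regroup = solveℤ

  scaleₚ-+ₚ : ∀ a r s → scaleₚ a (r +ₚ s) ≋ (scaleₚ a r +ₚ scaleₚ a s)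
  scaleₚ-+ₚ a r s = mk≋ λ i → begin
    coeff (scaleₚ a (r +ₚ s)) i                   ≡⟨ coeff-scaleₚ a (r +ₚ s) i ⟩
    a *ℤ coeff (r +ₚ s) i                         ≡⟨ cong (a *ℤ_) (coeff-+ₚ r s i) ⟩
    a *ℤ (coeff r i +ℤ coeff s i)                 ≡⟨ ℤP.*-distribˡ-+ a (coeff r i) (coeff s i) ⟩
    a *ℤ coeff r i +ℤ a *ℤ coeff s i              ≡⟨ cong₂ _+ℤ_ (coeff-scaleₚ a r i) (coeff-scaleₚ a s i) ⟨
    coeff (scaleₚ a r) i +ℤ coeff (scaleₚ a s) i  ≡⟨ coeff-+ₚ (scaleₚ a r) (scaleₚ a s) i ⟨
    coeff (scaleₚ a r +ₚ scaleₚ a s) i            ∎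
    where open ≡-Reasoning

  scaleₚ-scaleₚ : ∀ a b s → scaleₚ a (scaleₚ b s) ≋ scaleₚ (a *ℤ b) s
  scaleₚ-scaleₚ a b s = mk≋ λ i →
    trans (coeff-scaleₚ a (scaleₚ b s) i)
      (trans (cong (a *ℤ_) (coeff-scaleₚ b s i))
        (trans (sym (ℤP.*-assoc a b (coeff s i))) (sym (coeff-scaleₚ (a *ℤ b) s i))))

  shift-*ₚ : ∀ p r → ((+ 0 ∷ p) *ₚ r) ≋ (+ 0 ∷ (p *ₚ r))
  shift-*ₚ p r = mk≋ λ
    { zero → trans (coeff-∷*ₚ-zero (+ 0) p r) (ℤP.*-zeroˡ (coeff r 0))
    ; (suc i) → trans (coeff-∷*ₚ-suc (+ 0) p r i)
        (trans (cong (_+ℤ coeff (p *ₚ r) i) (ℤP.*-zeroˡ (coeff r (suc i)))) (ℤP.+-identityˡ _)) }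

  scaleₚ-*ₚ : ∀ a r s → (scaleₚ a r *ₚ s) ≋ scaleₚ a (r *ₚ s)
  scaleₚ-*ₚ a [] s = ≋-refl
  scaleₚ-*ₚ a (b ∷ r) s = ≋-trans
    (+ₚ-cong (≋-sym (scaleₚ-scaleₚ a b s)) (∷-cong refl (scaleₚ-*ₚ a r s)))
    (≋-sym (≋-trans (scaleₚ-+ₚ a (scaleₚ b s) (+ 0 ∷ (r *ₚ s))) (+ₚ-cong ≋-refl (∷-cong (ℤP.*-zeroʳ a) ≋-refl))))

  *ₚ-assoc : ∀ p r s → ((p *ₚ r) *ₚ s) ≋ (p *ₚ (r *ₚ s))
  *ₚ-assoc [] r s = ≋-refl
  *ₚ-assoc (a ∷ p) r s = ≋-trans (*ₚ-distribʳ (scaleₚ a r) (+ 0 ∷ (p *ₚ r)) s)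
    (+ₚ-cong (scaleₚ-*ₚ a r s) (≋-trans (shift-*ₚ (p *ₚ r) s) (∷-cong refl (*ₚ-assoc p r s))))

  *ₚ-∷ : ∀ r a p → (r *ₚ (a ∷ p)) ≋ (scaleₚ a r +ₚ (+ 0 ∷ (r *ₚ p)))
  *ₚ-∷ [] a p = mk≋ λ { zero → refl ; (suc i) → refl }
  *ₚ-∷ (b ∷ r) a p = mk≋ λ
    { zero → trans (coeff-∷*ₚ-zero b r (a ∷ p)) (trans (ℤP.*-comm b a) (sym (ℤP.+-identityʳ _)))
    ; (suc i) → begin
        coeff ((b ∷ r) *ₚ (a ∷ p)) (suc i)                          ≡⟨ coeff-∷*ₚ-suc b r (a ∷ p) i ⟩
        b *ℤ coeff p i +ℤ coeff (r *ₚ (a ∷ p)) i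
          ≡⟨ cong (b *ℤ coeff p i +ℤ_) (trans (coeff≡ (*ₚ-∷ r a p) i) (coeff-+ₚ (scaleₚ a r) (+ 0 ∷ (r *ₚ p)) i)) ⟩
        b *ℤ coeff p i +ℤ (coeff (scaleₚ a r) i +ℤ coeff (+ 0 ∷ (r *ₚ p)) i)
          ≡⟨ exchange (b *ℤ coeff p i) (coeff (scaleₚ a r) i) (coeff (+ 0 ∷ (r *ₚ p)) i) ⟩
        coeff (scaleₚ a r) i +ℤ (b *ℤ coeff p i +ℤ coeff (+ 0 ∷ (r *ₚ p)) i)
          ≡⟨ cong (coeff (scaleₚ a r) i +ℤ_) (cong (_+ℤ coeff (+ 0 ∷ (r *ₚ p)) i) (coeff-scaleₚ b p i)) ⟨
        coeff (scaleₚ a r) i +ℤ (coeff (scaleₚ b p) i +ℤ coeff (+ 0 ∷ (r *ₚ p)) i)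
          ≡⟨ cong (coeff (scaleₚ a r) i +ℤ_) (coeff-+ₚ (scaleₚ b p) (+ 0 ∷ (r *ₚ p)) i) ⟨
        coeff (scaleₚ a r) i +ℤ coeff ((b ∷ r) *ₚ p) i
          ≡⟨ coeff-+ₚ (scaleₚ a r) ((b ∷ r) *ₚ p) i ⟨
        coeff (scaleₚ a (b ∷ r) +ₚ (+ 0 ∷ ((b ∷ r) *ₚ p))) (suc i)  ∎ }
    where
    open ≡-Reasoning
    exchange : ∀ x y z → x +ℤ (y +ℤ z) ≡ y +ℤ (x +ℤ z)
    exchange = solveℤ

  *ₚ-comm : ∀ p r → (p *ₚ r) ≋ (r *ₚ p)
  *ₚ-comm [] r = ≋-sym (*ₚ-zeroʳ r)
  *ₚ-comm (a ∷ p) r = ≋-trans (+ₚ-cong (≋-refl {scaleₚ a r}) (∷-cong refl (*ₚ-comm p r))) (≋-sym (*ₚ-∷ r a p))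

  *ₚ-identityˡ : ∀ p → (1ₚ *ₚ p) ≋ p
  *ₚ-identityˡ p = mk≋ λ i → begin
    coeff (scaleₚ (+ 1) p +ₚ (+ 0 ∷ [])) i          ≡⟨ coeff-+ₚ (scaleₚ (+ 1) p) (+ 0 ∷ []) i ⟩
    coeff (scaleₚ (+ 1) p) i +ℤ coeff (+ 0 ∷ []) i  ≡⟨ cong₂ _+ℤ_ (coeff-scaleₚ (+ 1) p i) (coeff-zero i) ⟩
    + 1 *ℤ coeff p i +ℤ + 0                         ≡⟨ ℤP.+-identityʳ _ ⟩
    + 1 *ℤ coeff p i                                ≡⟨ ℤP.*-identityˡ (coeff p i) ⟩
    coeff p i                                       ∎
    where
    open ≡-Reasoning
    coeff-zero : ∀ i → coeff (+ 0 ∷ []) i ≡ + 0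
    coeff-zero zero = refl
    coeff-zero (suc i) = refl

  *ₚ-distribˡ : ∀ p r s → (p *ₚ (r +ₚ s)) ≋ ((p *ₚ r) +ₚ (p *ₚ s))
  *ₚ-distribˡ p r s = ≋-trans (*ₚ-comm p (r +ₚ s))
    (≋-trans (*ₚ-distribʳ r s p) (+ₚ-cong (*ₚ-comm r p) (*ₚ-comm s p)))

  ℤ[q] : CommutativeRing _ _
  ℤ[q] = record
    { Carrier = Poly ; _≈_ = _≋_ ; _+_ = _+ₚ_ ; _*_ = _*ₚ_ ; -_ = negₚ ; 0# = [] ; 1# = 1ₚ
    ; isCommutativeRing = record
      { isRing = record
        { +-isAbelianGroup = record
          { isGroup = record
            { isMonoid = record
              { isSemigroup = record
                { isMagma = record
                  { isEquivalence = record { refl = ≋-refl ; sym = ≋-sym ; trans = ≋-trans }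
                  ; ∙-cong = +ₚ-cong }
                ; assoc = +ₚ-assoc }
              ; identity = (λ _ → ≋-refl) , +ₚ-identityʳ }
            ; inverse = +ₚ-inverseˡ , +ₚ-inverseʳ
            ; ⁻¹-cong = negₚ-cong }
          ; comm = +ₚ-comm }
        ; *-cong = *ₚ-cong
        ; *-assoc = *ₚ-assoc
        ; *-identity = *ₚ-identityˡ , (λ p → ≋-trans (*ₚ-comm p 1ₚ) (*ₚ-identityˡ p))
        ; distrib = *ₚ-distribˡ , (λ p r s → *ₚ-distribʳ r s p) }
      ; *-comm = *ₚ-comm } }

module ListSum {c ℓ} (M : CommutativeMonoid c ℓ) where

  open CommutativeMonoid M
    renaming (Carrier to C; refl to ≈-refl; sym to ≈-sym; trans to ≈-trans; reflexive to ≈-reflexive)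
  open import Algebra.Properties.CommutativeSemigroup commutativeSemigroup using (interchange)
  open import Relation.Binary.Reasoning.Setoid setoid

  private variable
    a b : Level
    A : Set a
    B : Set b

  ∑ : List A → (A → C) → C
  ∑ xs h = foldr _∙_ ε (map h xs)

  syntax ∑ xs (λ x → e) = ∑[ x ∈ xs ] e

  ∑-cong : ∀ (xs : List A) {h g : A → C} → (∀ x → h x ≈ g x) → ∑ xs h ≈ ∑ xs g
  ∑-cong [] e = ≈-refl
  ∑-cong (x ∷ xs) e = ∙-cong (e x) (∑-cong xs e)

  ∑-zero : ∀ (xs : List A) {h : A → C} → (∀ x → h x ≈ ε) → ∑ xs h ≈ ε
  ∑-zero [] e = ≈-refl
  ∑-zero (x ∷ xs) e = ≈-trans (∙-cong (e x) (∑-zero xs e)) (identityˡ ε)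

  ∑-distrib-∙ : ∀ (xs : List A) (h g : A → C) → ∑[ x ∈ xs ] (h x ∙ g x) ≈ ∑ xs h ∙ ∑ xs g
  ∑-distrib-∙ [] h g = ≈-sym (identityˡ ε)
  ∑-distrib-∙ (x ∷ xs) h g = begin
    (h x ∙ g x) ∙ ∑[ x ∈ xs ] (h x ∙ g x)  ≈⟨ ∙-cong ≈-refl (∑-distrib-∙ xs h g) ⟩
    (h x ∙ g x) ∙ (∑ xs h ∙ ∑ xs g)        ≈⟨ interchange (h x) (g x) (∑ xs h) (∑ xs g) ⟩
    (h x ∙ ∑ xs h) ∙ (g x ∙ ∑ xs g)        ∎

  ∑-comm : ∀ (xs : List A) (ys : List B) (h : A → B → C) →
    ∑[ x ∈ xs ] ∑ ys (h x) ≈ ∑[ y ∈ ys ] ∑[ x ∈ xs ] h x y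
  ∑-comm [] ys h = ≈-sym (∑-zero ys (λ _ → ≈-refl))
  ∑-comm (x ∷ xs) ys h =
    ≈-trans (∙-cong ≈-refl (∑-comm xs ys h)) (≈-sym (∑-distrib-∙ ys (h x) (λ y → ∑[ x ∈ xs ] h x y)))

  ∑-++ : ∀ (xs ys : List A) (h : A → C) → ∑ (xs ++ ys) h ≈ ∑ xs h ∙ ∑ ys h
  ∑-++ [] ys h = ≈-sym (identityˡ _)
  ∑-++ (x ∷ xs) ys h = ≈-trans (∙-cong ≈-refl (∑-++ xs ys h)) (≈-sym (assoc _ _ _))

  ∑-concatMap : ∀ (f : A → List B) (xs : List A) (h : B → C) →
    ∑ (concatMap f xs) h ≈ ∑[ x ∈ xs ] ∑ (f x) h
  ∑-concatMap f [] h = ≈-refl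
  ∑-concatMap f (x ∷ xs) h = ≈-trans (∑-++ (f x) (concatMap f xs) h) (∙-cong ≈-refl (∑-concatMap f xs h))

  ∑-map : ∀ (f : A → B) (xs : List A) (h : B → C) → ∑ (map f xs) h ≈ ∑[ x ∈ xs ] h (f x)
  ∑-map f [] h = ≈-refl
  ∑-map f (x ∷ xs) h = ∙-cong ≈-refl (∑-map f xs h)

  ∑-if : ∀ (xs : List A) (b : Bool) (h : A → C) → (if b then ∑ xs h else ε) ≈ ∑[ x ∈ xs ] (if b then h x else ε)
  ∑-if xs true h = ≈-refl
  ∑-if xs false h = ≈-sym (∑-zero xs (λ _ → ≈-refl))

  ∑-allFin-suc : ∀ n (h : Fin (suc n) → C) → ∑ (allFin (suc n)) h ≈ h zero ∙ ∑[ i ∈ allFin n ] h (suc i)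
  ∑-allFin-suc n h = ∙-cong ≈-refl (≈-reflexive (cong (foldr _∙_ ε)
    (trans (map-tabulate suc h) (sym (map-tabulate id (h ∘ suc))))))

  ∑-allFuns-suc : ∀ d (xs : List A) (h : (Fin (suc d) → A) → C) →
    ∑ (allFuns (suc d) xs) h ≈ ∑[ x ∈ xs ] ∑[ g ∈ allFuns d xs ] h (x ∷ᶠ g)
  ∑-allFuns-suc d xs h = ≈-trans (∑-concatMap _ xs h) (∑-cong xs (λ x → ∑-map (x ∷ᶠ_) (allFuns d xs) h))

  -- xs meets every ~-class exactly once, phrased by its effect on sums.
  Enumerates : ∀ {r} → List A → (A → A → Set r) → Set _
  Enumerates {A = A} xs _~_ = ∀ (h : A → C) a →
    (∀ x → ¬ x ~ a → h x ≈ ε) → (∀ x → x ~ a → h x ≈ h a) → ∑ xs h ≈ h a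

  allFin-enumerates : ∀ n → Enumerates (allFin n) _≡_
  allFin-enumerates (suc n) h zero off on = begin
    ∑ (allFin (suc n)) h                  ≈⟨ ∑-allFin-suc n h ⟩
    h zero ∙ ∑[ i ∈ allFin n ] h (suc i)  ≈⟨ ∙-cong ≈-refl (∑-zero (allFin n) (λ i → off (suc i) λ ())) ⟩
    h zero ∙ ε                            ≈⟨ identityʳ _ ⟩
    h zero                                ∎
  allFin-enumerates (suc n) h (suc a) off on = begin
    ∑ (allFin (suc n)) h                  ≈⟨ ∑-allFin-suc n h ⟩
    h zero ∙ ∑[ i ∈ allFin n ] h (suc i)  ≈⟨ ∙-cong (off zero λ ()) (allFin-enumerates n (h ∘ suc) a off′ on′) ⟩
    ε ∙ h (suc a)                         ≈⟨ identityˡ _ ⟩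
    h (suc a)                             ∎
    where
    off′ : ∀ i → ¬ i ≡ a → h (suc i) ≈ ε
    off′ i i≢a = off (suc i) (i≢a ∘ FinP.suc-injective)
    on′ : ∀ i → i ≡ a → h (suc i) ≈ h (suc a)
    on′ i i≡a = on (suc i) (cong suc i≡a)

  bools-enumerate : Enumerates (true ∷ false ∷ []) _≡_
  bools-enumerate h true off on =
    ≈-trans (∙-cong ≈-refl (≈-trans (∙-cong (off false λ ()) ≈-refl) (identityˡ ε))) (identityʳ _)
  bools-enumerate h false off on = ≈-trans (∙-cong (off true λ ()) (identityʳ _)) (identityˡ _)

  allFuns-enumerates : ∀ {r} {_~_ : A → A → Set r} (xs : List A) → (∀ x → x ~ x) →
    Enumerates xs _~_ → ∀ d → Enumerates (allFuns d xs) (Pointwise _~_)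
  allFuns-enumerates xs ~-refl enum zero h a off on = ≈-trans (identityʳ _) (on (λ ()) (λ ()))
  allFuns-enumerates {A = A} {_~_ = _~_} xs ~-refl enum (suc d) h a off on = begin
    ∑ (allFuns (suc d) xs) h  ≈⟨ ∑-allFuns-suc d xs h ⟩
    ∑ xs H                    ≈⟨ enum H (a zero) H-off H-on ⟩
    H (a zero)                ≈⟨ H-tail (a zero) (~-refl (a zero)) ⟩
    h (a zero ∷ᶠ (a ∘ suc))   ≈⟨ on _ (cons~ (~-refl (a zero))) ⟩
    h a                       ∎
    where
    H : A → C
    H x = ∑[ g ∈ allFuns d xs ] h (x ∷ᶠ g)
    cons~ : ∀ {x} → x ~ a zero → Pointwise _~_ (x ∷ᶠ (a ∘ suc)) a
    cons~ x~a zero = x~a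
    cons~ x~a (suc i) = ~-refl (a (suc i))
    H-tail : ∀ x → x ~ a zero → H x ≈ h (x ∷ᶠ (a ∘ suc))
    H-tail x x~a = allFuns-enumerates xs ~-refl enum d (λ g → h (x ∷ᶠ g)) (a ∘ suc)
      (λ g g≁ → off (x ∷ᶠ g) (λ x∷g~a → g≁ (x∷g~a ∘ suc)))
      (λ g g~ → ≈-trans (on (x ∷ᶠ g) λ { zero → x~a ; (suc i) → g~ i })
                        (≈-sym (on (x ∷ᶠ (a ∘ suc)) (cons~ x~a))))
    H-off : ∀ x → ¬ x ~ a zero → H x ≈ ε
    H-off x x≁ = ∑-zero (allFuns d xs) (λ g → off (x ∷ᶠ g) (λ x∷g~a → x≁ (x∷g~a zero)))
    H-on : ∀ x → x ~ a zero → H x ≈ H (a zero)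
    H-on x x~a = begin
      H x                      ≈⟨ H-tail x x~a ⟩
      h (x ∷ᶠ (a ∘ suc))       ≈⟨ on _ (cons~ x~a) ⟩
      h a                      ≈⟨ on _ (cons~ (~-refl (a zero))) ⟨
      h (a zero ∷ᶠ (a ∘ suc))  ≈⟨ H-tail (a zero) (~-refl (a zero)) ⟨
      H (a zero)               ∎

  ∑-permute : ∀ d (y y⁻¹ : Fin d → Fin d) → (∀ i → y⁻¹ (y i) ≡ i) → (∀ v → y (y⁻¹ v) ≡ v) → ∀ (g : Fin d → C) →
    ∑[ i ∈ allFin d ] g (y i) ≈ ∑ (allFin d) g
  ∑-permute d y y⁻¹ y⁻¹y yy⁻¹ g = begin
    ∑[ i ∈ allFin d ] g (y i)                      ≈⟨ ∑-cong (allFin d) (λ i → ≈-sym (by-v i)) ⟩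
    ∑[ i ∈ allFin d ] ∑[ v ∈ allFin d ] δ (y i) v  ≈⟨ ∑-comm (allFin d) (allFin d) (δ ∘ y) ⟩
    ∑[ v ∈ allFin d ] ∑[ i ∈ allFin d ] δ (y i) v  ≈⟨ ∑-cong (allFin d) by-i ⟩
    ∑ (allFin d) g                                 ∎
    where
    δ : Fin d → Fin d → C
    δ u v = if does (u Fin.≟ v) then g v else ε
    δ-diag : ∀ {u v} → u ≡ v → δ u v ≈ g v
    δ-diag {u} {v} u≡v rewrite dec-true (u Fin.≟ v) u≡v = ≈-refl
    δ-off : ∀ {u v} → ¬ u ≡ v → δ u v ≈ ε
    δ-off {u} {v} u≢v rewrite dec-false (u Fin.≟ v) u≢v = ≈-refl
    by-v : ∀ i → ∑[ v ∈ allFin d ] δ (y i) v ≈ g (y i)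
    by-v i = ≈-trans (allFin-enumerates d (δ (y i)) (y i) (λ v v≢ → δ-off (v≢ ∘ sym)) (λ { v refl → ≈-refl }))
                     (δ-diag refl)
    by-i : ∀ v → ∑[ i ∈ allFin d ] δ (y i) v ≈ g v
    by-i v = ≈-trans
      (allFin-enumerates d (λ i → δ (y i) v) (y⁻¹ v)
        (λ i i≢y⁻¹v → δ-off (λ yi≡v → i≢y⁻¹v (trans (sym (y⁻¹y i)) (cong y⁻¹ yi≡v))))
        (λ { i refl → ≈-refl }))
      (δ-diag (yy⁻¹ v))

module QPoly where

  open PolyRing public
  open ListSum (CommutativeRing.+-commutativeMonoid ℤ[q]) public

  module ≋-Reasoning = Relation.Binary.Reasoning.Setoid (CommutativeRing.setoid ℤ[q])

  record TopTerm (p : Poly) (a : ℕ) (α : ℤ) : Set where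
    constructor topTerm
    field
      top : coeff p a ≡ α
      above : ∀ j → a ℕ.< j → coeff p j ≡ + 0
  open TopTerm public

  TopTerm-cong : ∀ {p r a α} → p ≋ r → TopTerm p a α → TopTerm r a α
  TopTerm-cong {a = a} p≋r (topTerm t ab) =
    topTerm (trans (sym (coeff≡ p≋r a)) t) λ j a<j → trans (sym (coeff≡ p≋r j)) (ab j a<j)

  TopTerm-shift : ∀ {p a α} → TopTerm p a α → TopTerm (+ 0 ∷ p) (suc a) α
  TopTerm-shift (topTerm t ab) = topTerm t λ { (suc j) (ℕ.s<s a<j) → ab j a<j }

  TopTerm-scaleₚ : ∀ c {p a α} → TopTerm p a α → TopTerm (scaleₚ c p) a (c *ℤ α)
  TopTerm-scaleₚ c {p} {a} (topTerm t ab) = topTerm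
    (trans (coeff-scaleₚ c p a) (cong (c *ℤ_) t))
    (λ j a<j → trans (coeff-scaleₚ c p j) (trans (cong (c *ℤ_) (ab j a<j)) (ℤP.*-zeroʳ c)))

  TopTerm-+ₚ-lower : ∀ {p a α} r → TopTerm p a α → (∀ j → a ℕ.≤ j → coeff r j ≡ + 0) → TopTerm (r +ₚ p) a α
  TopTerm-+ₚ-lower {p} {a} {α} r (topTerm t ab) low = topTerm
    (trans (coeff-+ₚ r p a) (trans (cong₂ _+ℤ_ (low a ℕP.≤-refl) t) (ℤP.+-identityˡ α)))
    (λ j a<j → trans (coeff-+ₚ r p j) (cong₂ _+ℤ_ (low j (ℕP.<⇒≤ a<j)) (ab j a<j)))

  TopTerm-*ₚ : ∀ p {r a b α β} → TopTerm p a α → TopTerm r b β → TopTerm (p *ₚ r) (a ℕ.+ b) (α *ℤ β)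
  TopTerm-*ₚ [] {β = β} (topTerm t _) _ = topTerm (trans (sym (ℤP.*-zeroˡ β)) (cong (_*ℤ β) t)) λ _ _ → refl
  TopTerm-*ₚ (c ∷ p) {r} {zero} (topTerm refl ab) r-top =
    TopTerm-cong (≋-sym (≋-trans (+ₚ-congˡ (scaleₚ c r) tail≋[]) (+ₚ-identityʳ (scaleₚ c r)))) (TopTerm-scaleₚ c r-top)
    where
    tail≋[] : (+ 0 ∷ (p *ₚ r)) ≋ []
    tail≋[] = ∷-≋-[] refl (*ₚ-zeroˡ-≋ {p} r (mk≋ λ j → ab (suc j) ℕ.z<s))
  TopTerm-*ₚ (c ∷ p) {r} {suc a} {b} (topTerm t ab) r-top =
    TopTerm-+ₚ-lower (scaleₚ c r)
      (TopTerm-shift (TopTerm-*ₚ p (topTerm t λ j a<j → ab (suc j) (ℕ.s<s a<j)) r-top))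
      (λ j a+b<j → trans (coeff-scaleₚ c r j)
        (trans (cong (c *ℤ_) (above r-top j (ℕP.<-≤-trans (ℕ.s≤s (ℕP.m≤n+m b a)) a+b<j))) (ℤP.*-zeroʳ c)))

  Leading : Poly → Set
  Leading p = Σ ℕ λ a → Σ ℤ λ α → ¬ α ≡ + 0 × TopTerm p a α

  ≋[]⊎leading : ∀ p → p ≋ [] ⊎ Leading p
  ≋[]⊎leading [] = inj₁ ≋-refl
  ≋[]⊎leading (c ∷ p) with ≋[]⊎leading p
  ... | inj₂ (a , α , α≢0 , topTerm t ab) = inj₂ (suc a , α , α≢0 , topTerm t λ { (suc j) (ℕ.s<s a<j) → ab j a<j })
  ... | inj₁ p≋[] with c ℤ.≟ + 0
  ...   | yes c≡0 = inj₁ (∷-≋-[] c≡0 p≋[])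
  ...   | no c≢0 = inj₂ (0 , c , c≢0 , topTerm refl λ { (suc j) _ → coeff≡ p≋[] j })

  -- The ring solver needs a genuine zero test: with λ _ → nothing it fails on some identities below.
  ℤ[q]-solverRing : ACR.AlmostCommutativeRing _ _
  ℤ[q]-solverRing = ACR.fromCommutativeRing ℤ[q] λ p → [ just ∘ ≋-sym , const nothing ]′ (≋[]⊎leading p)

  q : Poly
  q = qpow 1

  q*ₚ : ∀ p → (q *ₚ p) ≋ (+ 0 ∷ p)
  q*ₚ p = ≋-trans (shift-*ₚ 1ₚ p) (∷-cong refl (*ₚ-identityˡ p))

  ∷-as-+ₚ : ∀ a p → (a ∷ p) ≋ ((a ∷ []) +ₚ (q *ₚ p))
  ∷-as-+ₚ a p = ≋-trans (∷-cong (sym (ℤP.+-identityʳ a)) ≋-refl) (+ₚ-congˡ (a ∷ []) (≋-sym (q*ₚ p)))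

  qpow-suc : ∀ m → qpow (suc m) ≋ (q *ₚ qpow m)
  qpow-suc m = ≋-sym (q*ₚ (qpow m))

  qpow-+ : ∀ a b → qpow (a ℕ.+ b) ≋ (qpow a *ₚ qpow b)
  qpow-+ zero b = ≋-sym (*ₚ-identityˡ (qpow b))
  qpow-+ (suc a) b = ≋-trans (∷-cong refl (qpow-+ a b)) (≋-sym (shift-*ₚ (qpow a) (qpow b)))

  qint-suc : ∀ n → qint (suc n) ≋ (1ₚ +ₚ (q *ₚ qint n))
  qint-suc n = ∷-as-+ₚ (+ 1) (qint n)

  qint-+ : ∀ a b → qint (a ℕ.+ b) ≋ (qint a +ₚ (qpow a *ₚ qint b))
  qint-+ zero b = ≋-sym (*ₚ-identityˡ (qint b))
  qint-+ (suc a) b = begin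
    qint (suc a ℕ.+ b)                              ≈⟨ qint-suc (a ℕ.+ b) ⟩
    1ₚ +ₚ q *ₚ qint (a ℕ.+ b)                       ≈⟨ +ₚ-congˡ 1ₚ (*ₚ-congˡ q (qint-+ a b)) ⟩
    1ₚ +ₚ q *ₚ (qint a +ₚ qpow a *ₚ qint b)         ≈⟨ regroup 1ₚ q (qint a) (qpow a) (qint b) ⟩
    (1ₚ +ₚ q *ₚ qint a) +ₚ (q *ₚ qpow a) *ₚ qint b  ≈⟨ +ₚ-cong (qint-suc a) (*ₚ-congʳ (qint b) (qpow-suc a)) ⟨
    qint (suc a) +ₚ qpow (suc a) *ₚ qint b          ∎
    where
    open ≋-Reasoning
    regroup : ∀ o x y z w → (o +ₚ (x *ₚ (y +ₚ (z *ₚ w)))) ≋ ((o +ₚ (x *ₚ y)) +ₚ ((x *ₚ z) *ₚ w))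
    regroup = solve-∀ ℤ[q]-solverRing

  *ₚ-distribˡ-∑ : ∀ {a} {A : Set a} (xs : List A) (c : Poly) (h : A → Poly) → (c *ₚ ∑ xs h) ≋ ∑[ x ∈ xs ] (c *ₚ h x)
  *ₚ-distribˡ-∑ [] c h = *ₚ-zeroʳ c
  *ₚ-distribˡ-∑ (x ∷ xs) c h = ≋-trans (*ₚ-distribˡ c (h x) (∑ xs h)) (+ₚ-congˡ (c *ₚ h x) (*ₚ-distribˡ-∑ xs c h))

  *ₚ-distribˡ-∑-if : ∀ {a} {A : Set a} (xs : List A) (b : A → Bool) (c : Poly) (h : A → Poly) →
    (c *ₚ ∑[ x ∈ xs ] (if b x then h x else [])) ≋ ∑[ x ∈ xs ] (if b x then c *ₚ h x else [])
  *ₚ-distribˡ-∑-if xs b c h = ≋-trans (*ₚ-distribˡ-∑ xs c _) (∑-cong xs λ x → *ₚ-if (b x))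
    where
    *ₚ-if : ∀ b {A} → (c *ₚ (if b then A else [])) ≋ (if b then c *ₚ A else [])
    *ₚ-if true = ≋-refl
    *ₚ-if false = *ₚ-zeroʳ c

  leading⇒≉[] : ∀ {p} → Leading p → ¬ p ≋ []
  leading⇒≉[] (a , α , α≢0 , p-top) p≋[] = α≢0 (trans (sym (top p-top)) (coeff≡ p≋[] a))

  *ₚ-≉[] : ∀ {p r} → ¬ p ≋ [] → ¬ r ≋ [] → ¬ (p *ₚ r) ≋ []
  *ₚ-≉[] {p} {r} p≉[] r≉[] with ≋[]⊎leading p | ≋[]⊎leading r
  ... | inj₁ p≋[] | _ = λ _ → p≉[] p≋[]
  ... | _ | inj₁ r≋[] = λ _ → r≉[] r≋[]
  ... | inj₂ (a , α , α≢0 , p-top) | inj₂ (b , β , β≢0 , r-top) = λ pr≋[] →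
    [ α≢0 , β≢0 ]′ (ℤP.i*j≡0⇒i≡0∨j≡0 α (trans (sym (top (TopTerm-*ₚ p p-top r-top))) (coeff≡ pr≋[] (a ℕ.+ b))))

  *ₚ-cancelˡ : ∀ c {p r} → ¬ c ≋ [] → (c *ₚ p) ≋ (c *ₚ r) → p ≋ r
  *ₚ-cancelˡ c {p} {r} c≉[] cp≋cr with ≋[]⊎leading (p +ₚ negₚ r)
  ... | inj₁ p-r≋[] = begin
    p                   ≈⟨ split p r ⟩
    (p +ₚ negₚ r) +ₚ r  ≈⟨ +ₚ-congʳ r p-r≋[] ⟩
    r                   ∎
    where
    open ≋-Reasoning
    split : ∀ p r → p ≋ ((p +ₚ negₚ r) +ₚ r)
    split = solve-∀ ℤ[q]-solverRing
  ... | inj₂ p-r-leading = ⊥-elim (*ₚ-≉[] c≉[] (leading⇒≉[] p-r-leading) (begin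
    c *ₚ (p +ₚ negₚ r)       ≈⟨ distrib c p r ⟩
    c *ₚ p +ₚ negₚ (c *ₚ r)  ≈⟨ +ₚ-congʳ (negₚ (c *ₚ r)) cp≋cr ⟩
    c *ₚ r +ₚ negₚ (c *ₚ r)  ≈⟨ +ₚ-inverseʳ (c *ₚ r) ⟩
    []                       ∎))
    where
    open ≋-Reasoning
    distrib : ∀ c p r → (c *ₚ (p +ₚ negₚ r)) ≋ ((c *ₚ p) +ₚ negₚ (c *ₚ r))
    distrib = solve-∀ ℤ[q]-solverRing

  qpow-top : ∀ k → TopTerm (qpow k) k (+ 1)
  qpow-top zero = topTerm refl λ { (suc j) _ → refl }
  qpow-top (suc k) = TopTerm-shift (qpow-top k)

  qint-top : ∀ k → TopTerm (qint (suc k)) k (+ 1)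
  qint-top zero = topTerm refl λ { (suc j) _ → refl }
  qint-top (suc k) = topTerm (top (qint-top k)) λ { (suc j) (ℕ.s<s k<j) → above (qint-top k) j k<j }

  qpow-≉[] : ∀ k → ¬ qpow k ≋ []
  qpow-≉[] k = leading⇒≉[] (k , + 1 , (λ ()) , qpow-top k)

  qfact-≉[] : ∀ d → ¬ qfact d ≋ []
  qfact-≉[] zero = qpow-≉[] 0
  qfact-≉[] (suc d) = *ₚ-≉[] (qfact-≉[] d) (leading⇒≉[] (d , + 1 , (λ ()) , qint-top d))

module XPoly where

  open QPoly

  infixl 6 _+ₓ_
  _+ₓ_ : List Poly → List Poly → List Poly
  [] +ₓ B = B
  (a ∷ A) +ₓ [] = a ∷ A
  (a ∷ A) +ₓ (b ∷ B) = (a +ₚ b) ∷ (A +ₓ B)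

  scaleₓ : Poly → List Poly → List Poly
  scaleₓ c = map (c *ₚ_)

  linear*ₓ : Poly → Poly → List Poly → List Poly
  linear*ₓ α β A = ([] ∷ scaleₓ α A) +ₓ scaleₓ β A

  ∑ₓ : ∀ {a} {A : Set a} → List A → (A → List Poly) → List Poly
  ∑ₓ xs h = foldr _+ₓ_ [] (map h xs)

  evalX-+ₓ : ∀ A B x → evalX (A +ₓ B) x ≋ (evalX A x +ₚ evalX B x)
  evalX-+ₓ [] B x = ≋-refl
  evalX-+ₓ (a ∷ A) [] x = ≋-sym (+ₚ-identityʳ _)
  evalX-+ₓ (a ∷ A) (b ∷ B) x =
    ≋-trans (+ₚ-congˡ (a +ₚ b) (*ₚ-congˡ x (evalX-+ₓ A B x))) (regroup a b x (evalX A x) (evalX B x))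
    where
    regroup : ∀ a b x u v → ((a +ₚ b) +ₚ (x *ₚ (u +ₚ v))) ≋ ((a +ₚ (x *ₚ u)) +ₚ (b +ₚ (x *ₚ v)))
    regroup = solve-∀ ℤ[q]-solverRing

  evalX-scaleₓ : ∀ c A x → evalX (scaleₓ c A) x ≋ (c *ₚ evalX A x)
  evalX-scaleₓ c [] x = ≋-sym (*ₚ-zeroʳ c)
  evalX-scaleₓ c (a ∷ A) x =
    ≋-trans (+ₚ-congˡ (c *ₚ a) (*ₚ-congˡ x (evalX-scaleₓ c A x))) (regroup c a x (evalX A x))
    where
    regroup : ∀ c a x u → ((c *ₚ a) +ₚ (x *ₚ (c *ₚ u))) ≋ (c *ₚ (a +ₚ (x *ₚ u)))
    regroup = solve-∀ ℤ[q]-solverRing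

  evalX-linear*ₓ : ∀ α β A x → evalX (linear*ₓ α β A) x ≋ (((α *ₚ x) +ₚ β) *ₚ evalX A x)
  evalX-linear*ₓ α β A x = begin
    evalX (([] ∷ scaleₓ α A) +ₓ scaleₓ β A) x                  ≈⟨ evalX-+ₓ ([] ∷ scaleₓ α A) (scaleₓ β A) x ⟩
    ([] +ₚ x *ₚ evalX (scaleₓ α A) x) +ₚ evalX (scaleₓ β A) x  ≈⟨ +ₚ-cong (*ₚ-congˡ x (evalX-scaleₓ α A x)) (evalX-scaleₓ β A x) ⟩
    x *ₚ (α *ₚ evalX A x) +ₚ β *ₚ evalX A x                    ≈⟨ regroup α β x (evalX A x) ⟩
    ((α *ₚ x) +ₚ β) *ₚ evalX A x                               ∎
    where
    open ≋-Reasoning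
    regroup : ∀ α β x u → ((x *ₚ (α *ₚ u)) +ₚ (β *ₚ u)) ≋ (((α *ₚ x) +ₚ β) *ₚ u)
    regroup = solve-∀ ℤ[q]-solverRing

  evalX-∑ₓ : ∀ {a} {A : Set a} (xs : List A) (h : A → List Poly) x → evalX (∑ₓ xs h) x ≋ ∑[ a ∈ xs ] evalX (h a) x
  evalX-∑ₓ [] h x = ≋-refl
  evalX-∑ₓ (a ∷ xs) h x = ≋-trans (evalX-+ₓ (h a) (∑ₓ xs h) x) (+ₚ-congˡ (evalX (h a) x) (evalX-∑ₓ xs h x))


  evalX-∑ₓ-if : ∀ {a} {A : Set a} (xs : List A) (b : A → Bool) (h : A → List Poly) x →
    evalX (∑ₓ xs λ a → if b a then h a else []) x ≋ ∑[ a ∈ xs ] (if b a then evalX (h a) x else [])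
  evalX-∑ₓ-if xs b h x = ≋-trans (evalX-∑ₓ xs _ x) (∑-cong xs λ a → ≋-reflexive (evalX-if (b a)))
    where
    evalX-if : ∀ b {A} → evalX (if b then A else []) x ≡ (if b then evalX A x else [])
    evalX-if true = refl
    evalX-if false = refl

  coeffX-+ₓ : ∀ A B k → coeffX (A +ₓ B) k ≋ (coeffX A k +ₚ coeffX B k)
  coeffX-+ₓ [] B k = ≋-refl
  coeffX-+ₓ (a ∷ A) [] zero = ≋-sym (+ₚ-identityʳ a)
  coeffX-+ₓ (a ∷ A) [] (suc k) = ≋-sym (+ₚ-identityʳ (coeffX A k))
  coeffX-+ₓ (a ∷ A) (b ∷ B) zero = ≋-refl
  coeffX-+ₓ (a ∷ A) (b ∷ B) (suc k) = coeffX-+ₓ A B k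

  coeffX-scaleₓ : ∀ c A k → coeffX (scaleₓ c A) k ≋ (c *ₚ coeffX A k)
  coeffX-scaleₓ c [] k = ≋-sym (*ₚ-zeroʳ c)
  coeffX-scaleₓ c (a ∷ A) zero = ≋-refl
  coeffX-scaleₓ c (a ∷ A) (suc k) = coeffX-scaleₓ c A k

  record TopCoeffₓ (A : List Poly) (k : ℕ) (c : Poly) : Set where
    constructor topCoeffₓ
    field
      topₓ : coeffX A k ≋ c
      aboveₓ : ∀ j → k ℕ.< j → coeffX A j ≋ []
  open TopCoeffₓ public

  TopCoeffₓ-cong : ∀ {A k c c′} → c ≋ c′ → TopCoeffₓ A k c → TopCoeffₓ A k c′
  TopCoeffₓ-cong c≋c′ (topCoeffₓ t ab) = topCoeffₓ (≋-trans t c≋c′) ab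

  TopCoeffₓ-[] : ∀ k → TopCoeffₓ [] k []
  TopCoeffₓ-[] k = topCoeffₓ ≋-refl λ _ _ → ≋-refl

  TopCoeffₓ-const : ∀ c → TopCoeffₓ (c ∷ []) 0 c
  TopCoeffₓ-const c = topCoeffₓ ≋-refl λ { (suc j) _ → ≋-refl }

  TopCoeffₓ-+ₓ : ∀ {A B k c c′} → TopCoeffₓ A k c → TopCoeffₓ B k c′ → TopCoeffₓ (A +ₓ B) k (c +ₚ c′)
  TopCoeffₓ-+ₓ {A} {B} {k} (topCoeffₓ t ab) (topCoeffₓ t′ ab′) = topCoeffₓ
    (≋-trans (coeffX-+ₓ A B k) (+ₚ-cong t t′))
    (λ j k<j → ≋-trans (coeffX-+ₓ A B j) (+ₚ-cong (ab j k<j) (ab′ j k<j)))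

  TopCoeffₓ-scaleₓ : ∀ s {A k c} → TopCoeffₓ A k c → TopCoeffₓ (scaleₓ s A) k (s *ₚ c)
  TopCoeffₓ-scaleₓ s {A} {k} (topCoeffₓ t ab) = topCoeffₓ
    (≋-trans (coeffX-scaleₓ s A k) (*ₚ-congˡ s t))
    (λ j k<j → ≋-trans (coeffX-scaleₓ s A j) (≋-trans (*ₚ-congˡ s (ab j k<j)) (*ₚ-zeroʳ s)))

  TopCoeffₓ-linear*ₓ : ∀ α β {A k c} → TopCoeffₓ A k c → TopCoeffₓ (linear*ₓ α β A) (suc k) (α *ₚ c)
  TopCoeffₓ-linear*ₓ α β {A} {k} {c} (topCoeffₓ t ab) = topCoeffₓ
    (begin
      coeffX (linear*ₓ α β A) (suc k)           ≈⟨ coeff-split k ⟩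
      α *ₚ coeffX A k +ₚ β *ₚ coeffX A (suc k)  ≈⟨ +ₚ-cong (*ₚ-congˡ α t) (*ₚ-congˡ β (ab (suc k) ℕP.≤-refl)) ⟩
      α *ₚ c +ₚ β *ₚ []                         ≈⟨ +ₚ-congˡ (α *ₚ c) (*ₚ-zeroʳ β) ⟩
      α *ₚ c +ₚ []                              ≈⟨ +ₚ-identityʳ _ ⟩
      α *ₚ c                                    ∎)
    λ { (suc j) (ℕ.s<s k<j) → begin
      coeffX (linear*ₓ α β A) (suc j)           ≈⟨ coeff-split j ⟩
      α *ₚ coeffX A j +ₚ β *ₚ coeffX A (suc j)  ≈⟨ +ₚ-cong (*ₚ-congˡ α (ab j k<j)) (*ₚ-congˡ β (ab (suc j) (ℕP.m<n⇒m<1+n k<j))) ⟩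
      α *ₚ [] +ₚ β *ₚ []                        ≈⟨ +ₚ-cong (*ₚ-zeroʳ α) (*ₚ-zeroʳ β) ⟩
      []                                        ∎ }
    where
    open ≋-Reasoning
    coeff-split : ∀ j → coeffX (linear*ₓ α β A) (suc j) ≋ (α *ₚ coeffX A j +ₚ β *ₚ coeffX A (suc j))
    coeff-split j = ≋-trans (coeffX-+ₓ ([] ∷ scaleₓ α A) (scaleₓ β A) (suc j))
                            (+ₚ-cong (coeffX-scaleₓ α A j) (coeffX-scaleₓ β A (suc j)))

  TopCoeffₓ-∑ₓ : ∀ {a} {A : Set a} (xs : List A) {h : A → List Poly} {k} {c : A → Poly} →
    (∀ a → TopCoeffₓ (h a) k (c a)) → TopCoeffₓ (∑ₓ xs h) k (∑ xs c)
  TopCoeffₓ-∑ₓ [] {k = k} _ = TopCoeffₓ-[] k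
  TopCoeffₓ-∑ₓ (a ∷ xs) tops = TopCoeffₓ-+ₓ (tops a) (TopCoeffₓ-∑ₓ xs tops)

  TopCoeffₓ-∑ₓ-if : ∀ {a} {A : Set a} (xs : List A) (b : A → Bool) {h : A → List Poly} {k} {c : A → Poly} →
    (∀ a → T (b a) → TopCoeffₓ (h a) k (c a)) →
    TopCoeffₓ (∑ₓ xs λ a → if b a then h a else []) k (∑[ a ∈ xs ] (if b a then c a else []))
  TopCoeffₓ-∑ₓ-if xs b {k = k} tops = TopCoeffₓ-∑ₓ xs λ a → guarded (b a) (tops a)
    where
    guarded : ∀ b {A c} → (T b → TopCoeffₓ A k c) → TopCoeffₓ (if b then A else []) k (if b then c else [])
    guarded true top = top _
    guarded false _ = TopCoeffₓ-[] k

  evalX-≋[] : ∀ R x → (∀ k → coeffX R k ≋ []) → evalX R x ≋ []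
  evalX-≋[] [] x _ = ≋-refl
  evalX-≋[] (c ∷ R) x R≋[] =
    ≋-trans (+ₚ-cong (R≋[] 0) (*ₚ-congˡ x (evalX-≋[] R x (R≋[] ∘ suc)))) (*ₚ-zeroʳ x)

  -- If x has q-degree N and every coefficient of R has q-degree below N, the powers x^k
  -- occupy disjoint q-degree ranges, so the top x-term of R gives the top q-term of R(x).
  evalX-TopTerm : ∀ R {K a α N x} → (∀ k j → N ℕ.≤ j → coeff (coeffX R k) j ≡ + 0) → TopTerm x N (+ 1) →
    TopTerm (coeffX R K) a α → (∀ j → K ℕ.< j → coeffX R j ≋ []) → TopTerm (evalX R x) (a ℕ.+ K ℕ.* N) α
  evalX-TopTerm [] R-low x-top R-top R-above = topTerm (top R-top) λ _ _ → refl
  evalX-TopTerm (c ∷ R) {zero} {a} {x = x} R-low x-top R-top R-above =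
    subst (λ e → TopTerm (evalX (c ∷ R) x) e _) (sym (ℕP.+-identityʳ a))
      (TopTerm-cong (≋-sym (≋-trans (+ₚ-congˡ c (≋-trans (*ₚ-congˡ x (evalX-≋[] R x λ k → R-above (suc k) ℕ.z<s)) (*ₚ-zeroʳ x)))
                                    (+ₚ-identityʳ c)))
                    R-top)
  evalX-TopTerm (c ∷ R) {suc K} {a} {α} {N} {x} R-low x-top R-top R-above =
    subst (λ e → TopTerm (evalX (c ∷ R) x) e α) (reorder a K N)
      (TopTerm-+ₚ-lower c
        (subst (TopTerm (x *ₚ evalX R x) (N ℕ.+ (a ℕ.+ K ℕ.* N))) (ℤP.*-identityˡ α)
          (TopTerm-*ₚ x x-top (evalX-TopTerm R (R-low ∘ suc) x-top R-top (λ j K<j → R-above (suc j) (ℕ.s<s K<j)))))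
        (λ j N+a+KN≤j → R-low 0 j (ℕP.≤-trans (ℕP.m≤m+n N _) N+a+KN≤j)))
    where
    reorder : ∀ a K N → N ℕ.+ (a ℕ.+ K ℕ.* N) ≡ a ℕ.+ suc K ℕ.* N
    reorder = solveℕ

  coeff-length : ∀ p j → length p ℕ.≤ j → coeff p j ≡ + 0
  coeff-length [] j _ = refl
  coeff-length (a ∷ p) (suc j) (ℕ.s≤s len≤j) = coeff-length p j len≤j

  maxLength : List Poly → ℕ
  maxLength = foldr (λ p m → length p ℕ.⊔ m) 0

  coeff-maxLength : ∀ R k j → maxLength R ℕ.≤ j → coeff (coeffX R k) j ≡ + 0
  coeff-maxLength [] k j _ = refl
  coeff-maxLength (c ∷ R) zero j max≤j = coeff-length c j (ℕP.≤-trans (ℕP.m≤m⊔n _ _) max≤j)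
  coeff-maxLength (c ∷ R) (suc k) j max≤j = coeff-maxLength R k j (ℕP.≤-trans (ℕP.m≤n⊔m (length c) _) max≤j)

  LeadingX : List Poly → Set
  LeadingX R = Σ ℕ λ K → ¬ coeffX R K ≋ [] × (∀ j → K ℕ.< j → coeffX R j ≋ [])

  ≋[]⊎leadingX : ∀ R → (∀ k → coeffX R k ≋ []) ⊎ LeadingX R
  ≋[]⊎leadingX [] = inj₁ λ _ → ≋-refl
  ≋[]⊎leadingX (c ∷ R) with ≋[]⊎leadingX R
  ... | inj₂ (K , R-K≉[] , R-above) = inj₂ (suc K , R-K≉[] , λ { (suc j) (ℕ.s<s K<j) → R-above j K<j })
  ... | inj₁ R≋[] with ≋[]⊎leading c
  ...   | inj₁ c≋[] = inj₁ λ { zero → c≋[] ; (suc k) → R≋[] k }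
  ...   | inj₂ c-leading = inj₂ (0 , leading⇒≉[] c-leading , λ { (suc j) _ → R≋[] j })

  vanishing-on-qints⇒≋[] : ∀ R → (∀ n → 1 ℕ.≤ n → evalX R (qint n) ≋ []) → ∀ k → coeffX R k ≋ []
  vanishing-on-qints⇒≋[] R R[n]≋[] with ≋[]⊎leadingX R
  ... | inj₁ R≋[] = R≋[]
  ... | inj₂ (K , R-K≉[] , R-above) with ≋[]⊎leading (coeffX R K)
  ...   | inj₁ R-K≋[] = ⊥-elim (R-K≉[] R-K≋[])
  ...   | inj₂ (a , α , α≢0 , R-K-top) = ⊥-elim (α≢0 (trans (sym (top R[M+1]-top)) (coeff≡ (R[n]≋[] (suc M) (ℕ.s≤s ℕ.z≤n)) _)))
    where
    M = maxLength R
    R[M+1]-top = evalX-TopTerm R (coeff-maxLength R) (qint-top M) R-K-top R-above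

  interpolants-proportional : ∀ (χ : ℕ → Poly) P D P′ D′ →
    (∀ n → 1 ℕ.≤ n → evalX P (qint n) ≋ (D *ₚ χ n)) → (∀ n → 1 ℕ.≤ n → evalX P′ (qint n) ≋ (D′ *ₚ χ n)) →
    ∀ k → (D′ *ₚ coeffX P k) ≋ (D *ₚ coeffX P′ k)
  interpolants-proportional χ P D P′ D′ P-interp P′-interp k = begin
    D′ *ₚ coeffX P k                                            ≈⟨ add-cancel D D′ (coeffX P k) (coeffX P′ k) ⟩
    (D′ *ₚ coeffX P k +ₚ negₚ D *ₚ coeffX P′ k) +ₚ D *ₚ coeffX P′ k
      ≈⟨ +ₚ-congʳ (D *ₚ coeffX P′ k) (≋-trans (≋-sym (coeffX-R k)) (vanishing-on-qints⇒≋[] R R-vanishes k)) ⟩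
    D *ₚ coeffX P′ k                                            ∎
    where
    open ≋-Reasoning
    R = scaleₓ D′ P +ₓ scaleₓ (negₚ D) P′
    coeffX-R : ∀ k → coeffX R k ≋ (D′ *ₚ coeffX P k +ₚ negₚ D *ₚ coeffX P′ k)
    coeffX-R k = ≋-trans (coeffX-+ₓ (scaleₓ D′ P) (scaleₓ (negₚ D) P′) k)
                         (+ₚ-cong (coeffX-scaleₓ D′ P k) (coeffX-scaleₓ (negₚ D) P′ k))
    cross-cancel : ∀ D D′ X → ((D′ *ₚ (D *ₚ X)) +ₚ (negₚ D *ₚ (D′ *ₚ X))) ≋ []
    cross-cancel = solve-∀ ℤ[q]-solverRing
    add-cancel : ∀ D D′ a b → (D′ *ₚ a) ≋ (((D′ *ₚ a) +ₚ (negₚ D *ₚ b)) +ₚ (D *ₚ b))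
    add-cancel = solve-∀ ℤ[q]-solverRing
    R-vanishes : ∀ n → 1 ℕ.≤ n → evalX R (qint n) ≋ []
    R-vanishes n 1≤n = begin
      evalX R (qint n)
        ≈⟨ evalX-+ₓ (scaleₓ D′ P) (scaleₓ (negₚ D) P′) (qint n) ⟩
      evalX (scaleₓ D′ P) (qint n) +ₚ evalX (scaleₓ (negₚ D) P′) (qint n)
        ≈⟨ +ₚ-cong (evalX-scaleₓ D′ P (qint n)) (evalX-scaleₓ (negₚ D) P′ (qint n)) ⟩
      D′ *ₚ evalX P (qint n) +ₚ negₚ D *ₚ evalX P′ (qint n)
        ≈⟨ +ₚ-cong (*ₚ-congˡ D′ (P-interp n 1≤n)) (*ₚ-congˡ (negₚ D) (P′-interp n 1≤n)) ⟩
      D′ *ₚ (D *ₚ χ n) +ₚ negₚ D *ₚ (D′ *ₚ χ n)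
        ≈⟨ cross-cancel D D′ (χ n) ⟩
      []  ∎

module BoolView where

  open Equivalence

  T-∧⁺ : ∀ {a b} → T a → T b → T (a ∧ b)
  T-∧⁺ ta tb = from T-∧ (ta , tb)

  T-∧⁻ˡ : ∀ {a b} → T (a ∧ b) → T a
  T-∧⁻ˡ = proj₁ ∘ to T-∧

  T-∧⁻ʳ : ∀ {a b} → T (a ∧ b) → T b
  T-∧⁻ʳ = proj₂ ∘ to T-∧

  T-not⁺ : ∀ {a} → ¬ T a → T (not a)
  T-not⁺ {true} ¬ta = ¬ta _
  T-not⁺ {false} _ = _

  T-not⁻ : ∀ {a} → T (not a) → ¬ T a
  T-not⁻ {true} ()

  T-implies⁺ : ∀ {a b} → (T a → T b) → T (not a ∨ b)
  T-implies⁺ {a} a⇒b with T? a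
  ... | yes ta = from T-∨ (inj₂ (a⇒b ta))
  ... | no ¬ta = from T-∨ (inj₁ (T-not⁺ ¬ta))

  T-implies⁻ : ∀ {a b} → T (not a ∨ b) → T a → T b
  T-implies⁻ {a} t ta = [ (λ tna → ⊥-elim (T-not⁻ tna ta)) , id ]′ (to T-∨ t)

  ¬T⇒≡false : ∀ {a} → ¬ T a → a ≡ false
  ¬T⇒≡false = to T-not-≡ ∘ T-not⁺

  T⇒≡true : ∀ {a} → T a → a ≡ true
  T⇒≡true = to T-≡

  ≡true⇒T : ∀ {a} → a ≡ true → T a
  ≡true⇒T = from T-≡

  T-allF⁻ : ∀ {d} {f : Fin d → Bool} → T (allF f) → ∀ i → T (f i)
  T-allF⁻ {f = f} t i = All.lookup (all⁺ f (allFin _) t) (∈-allFin i)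

  T-allF⁺ : ∀ {d} {f : Fin d → Bool} → (∀ i → T (f i)) → T (allF f)
  T-allF⁺ {d} {f} h = all⁻ f (All.tabulate {xs = allFin d} λ {i} _ → h i)

  T-anyF⁻ : ∀ {d} (f : Fin d → Bool) → T (anyF f) → Σ (Fin d) (T ∘ f)
  T-anyF⁻ f t = Any.satisfied (any⁻ f (allFin _) t)

  T-anyF⁺ : ∀ {d} {f : Fin d → Bool} i → T (f i) → T (anyF f)
  T-anyF⁺ {f = f} i t = any⁺ f (lose (∈-allFin i) t)

  T-any-upTo⁻ : ∀ {d} (p : ℕ → Bool) → T (any p (upTo d)) → Σ ℕ (T ∘ p)
  T-any-upTo⁻ {d} p t = Any.satisfied (any⁻ p (upTo d) t)

  T-any-upTo⁺ : ∀ {d} {p : ℕ → Bool} {k} → k ℕ.< d → T (p k) → T (any p (upTo d))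
  T-any-upTo⁺ {p = p} k<d t = any⁺ p (lose (∈-upTo⁺ k<d) t)

  T-==⁻ : ∀ {d} {i j : Fin d} → T (i == j) → i ≡ j
  T-==⁻ = toWitness

  T-==⁺ : ∀ {d} {i j : Fin d} → i ≡ j → T (i == j)
  T-==⁺ = fromWitness

  allF-cong : ∀ {d} {f g : Fin d → Bool} → (∀ i → f i ≡ g i) → allF f ≡ allF g
  allF-cong f≗g = cong (foldr _∧_ true) (map-cong f≗g (allFin _))

  anyF-cong : ∀ {d} {f g : Fin d → Bool} → (∀ i → f i ≡ g i) → anyF f ≡ anyF g
  anyF-cong f≗g = cong (foldr _∨_ false) (map-cong f≗g (allFin _))

  any-upTo-cong : ∀ {d} {f g : ℕ → Bool} → (∀ i → f i ≡ g i) → any f (upTo d) ≡ any g (upTo d)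
  any-upTo-cong {d} f≗g = cong (foldr _∨_ false) (map-cong f≗g (upTo d))

module Colourings where

  open QPoly
  open BoolView

  colourings : (d n : ℕ) → List (Fin d → Fin n)
  colourings d n = allFuns d (allFin n)

  colourings-enumerate : ∀ d n → Enumerates (colourings d n) (Pointwise _≡_)
  colourings-enumerate d n = allFuns-enumerates (allFin n) (λ _ → refl) (allFin-enumerates n) d

  _≗ᵇ_ : ∀ {d n} → (Fin d → Fin n) → (Fin d → Fin n) → Bool
  f ≗ᵇ g = allF λ i → f i == g i

  ∑-∘-bijection : ∀ {d n} (y y⁻¹ : Fin d → Fin d) → (∀ i → y⁻¹ (y i) ≡ i) → (∀ v → y (y⁻¹ v) ≡ v) →
    (h : (Fin d → Fin n) → Poly) → (∀ {f g} → Pointwise _≡_ f g → h f ≋ h g) →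
    ∑[ c ∈ colourings d n ] h (c ∘ y) ≋ ∑ (colourings d n) h
  ∑-∘-bijection {d} {n} y y⁻¹ y⁻¹y yy⁻¹ h h-cong = begin
    ∑[ c ∈ colourings d n ] h (c ∘ y)                      ≈⟨ ∑-cong (colourings d n) (≋-sym ∘ by-f) ⟩
    ∑[ c ∈ colourings d n ] ∑[ f ∈ colourings d n ] δ c f  ≈⟨ ∑-comm (colourings d n) (colourings d n) δ ⟩
    ∑[ f ∈ colourings d n ] ∑[ c ∈ colourings d n ] δ c f  ≈⟨ ∑-cong (colourings d n) by-c ⟩
    ∑ (colourings d n) h                                   ∎
    where
    open ≋-Reasoning
    δ : (Fin d → Fin n) → (Fin d → Fin n) → Poly
    δ c f = if f ≗ᵇ (c ∘ y) then h f else []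
    δ-on : ∀ c {f} → Pointwise _≡_ f (c ∘ y) → δ c f ≋ h f
    δ-on c {f} f≗cy rewrite T⇒≡true (T-allF⁺ {f = λ i → f i == c (y i)} (T-==⁺ ∘ f≗cy)) = ≋-refl
    δ-off : ∀ c {f} → ¬ Pointwise _≡_ f (c ∘ y) → δ c f ≋ []
    δ-off c {f} f≉cy rewrite ¬T⇒≡false (λ t → f≉cy (λ i → T-==⁻ (T-allF⁻ {f = λ i → f i == c (y i)} t i))) = ≋-refl
    by-f : ∀ c → ∑[ f ∈ colourings d n ] δ c f ≋ h (c ∘ y)
    by-f c = ≋-trans (colourings-enumerate d n (δ c) (c ∘ y) (λ _ → δ-off c) on) (δ-on c λ _ → refl)
      where
      on : ∀ f → Pointwise _≡_ f (c ∘ y) → δ c f ≋ δ c (c ∘ y)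
      on f f≗cy = ≋-trans (δ-on c f≗cy) (≋-trans (h-cong f≗cy) (≋-sym (δ-on c λ _ → refl)))
    by-c : ∀ f → ∑[ c ∈ colourings d n ] δ c f ≋ h f
    by-c f = ≋-trans (colourings-enumerate d n (λ c → δ c f) (f ∘ y⁻¹) off on) (δ-on (f ∘ y⁻¹) f≗fy⁻¹y)
      where
      f≗fy⁻¹y : Pointwise _≡_ f (f ∘ y⁻¹ ∘ y)
      f≗fy⁻¹y i = cong f (sym (y⁻¹y i))
      off : ∀ c → ¬ Pointwise _≡_ c (f ∘ y⁻¹) → δ c f ≋ []
      off c c≉fy⁻¹ = δ-off c λ f≗cy → c≉fy⁻¹ λ v → trans (cong c (sym (yy⁻¹ v))) (sym (f≗cy (y⁻¹ v)))
      on : ∀ c → Pointwise _≡_ c (f ∘ y⁻¹) → δ c f ≋ δ (f ∘ y⁻¹) f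
      on c c≗fy⁻¹ = ≋-trans (δ-on c λ i → trans (f≗fy⁻¹y i) (sym (c≗fy⁻¹ (y i)))) (≋-sym (δ-on (f ∘ y⁻¹) f≗fy⁻¹y))

module Orientations where

  open QPoly
  open BoolView
  open Colourings

  increasingAlong : ∀ {d n} → Rel d → (Fin d → Fin n) → Bool
  increasingAlong ρ c = allF λ u → allF λ v → not (ρ u v) ∨ (toℕ (c u) <ᵇ toℕ (c v))

  module _ {d n} (ρ : Rel d) (c : Fin d → Fin n) where

    increasingAlong⁻ : T (increasingAlong ρ c) → ∀ u v → T (ρ u v) → toℕ (c u) ℕ.< toℕ (c v)
    increasingAlong⁻ t u v uv = ℕP.<ᵇ⇒< _ _ (T-implies⁻ (T-allF⁻ (T-allF⁻ t u) v) uv)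

    increasingAlong⁺ : (∀ u v → T (ρ u v) → toℕ (c u) ℕ.< toℕ (c v)) → T (increasingAlong ρ c)
    increasingAlong⁺ h = T-allF⁺ λ u → T-allF⁺ λ v → T-implies⁺ (ℕP.<⇒<ᵇ ∘ h u v)

    increasingAlong-walk : T (increasingAlong ρ c) → ∀ k u v → T (walk (suc k) ρ u v) → toℕ (c u) ℕ.< toℕ (c v)
    increasingAlong-walk inc k u v t with T-anyF⁻ (λ w → ρ u w ∧ walk k ρ w v) t
    ... | w , t′ with k
    ...   | zero = subst (λ z → toℕ (c u) ℕ.< toℕ (c z)) (T-==⁻ (T-∧⁻ʳ t′)) (increasingAlong⁻ inc u w (T-∧⁻ˡ t′))
    ...   | suc k = ℕP.<-trans (increasingAlong⁻ inc u w (T-∧⁻ˡ t′)) (increasingAlong-walk inc k w v (T-∧⁻ʳ t′))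

    increasingAlong-below : T (increasingAlong ρ c) → ∀ u v → T (below ρ u v) → toℕ (c u) ℕ.< toℕ (c v)
    increasingAlong-below inc u v t with T-any-upTo⁻ {d} (λ k → walk k ρ u v) (T-∧⁻ˡ t)
    ... | zero , u≡v = ⊥-elim (T-not⁻ (T-∧⁻ʳ t) u≡v)
    ... | suc k , w = increasingAlong-walk inc k u v w

  module _ {d} (adj ρ : Rel d) (orient : T (isOrientation adj ρ)) where

    orientation-at : ∀ u v → T (if adj u v then ρ u v xor ρ v u else not (ρ u v))
    orientation-at u v = T-allF⁻ (T-allF⁻ orient u) v

    orientation-nonedge : ∀ {u v} → adj u v ≡ false → ¬ T (ρ u v)
    orientation-nonedge {u} {v} nonedge with orientation-at u v
    ... | t rewrite nonedge = T-not⁻ t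

    orientation-edge : ∀ {u v} → adj u v ≡ true → ρ v u ≡ not (ρ u v)
    orientation-edge {u} {v} edge with orientation-at u v
    ... | t rewrite edge with ρ u v | ρ v u
    ... | true | false = refl
    ... | false | true = refl

    arc⇒below : (∀ u → adj u u ≡ false) → ∀ u v → T (ρ u v) → T (below ρ u v)
    arc⇒below loopless u v uv = T-∧⁺ (T-any-upTo⁺ (two≤d u v u≢v) one-step) (T-not⁺ (u≢v ∘ T-==⁻))
      where
      u≢v : ¬ u ≡ v
      u≢v refl = orientation-nonedge (loopless u) uv
      one-step : T (walk 1 ρ u v)
      one-step = T-anyF⁺ v (T-∧⁺ uv (T-==⁺ refl))
      two≤d : ∀ {d} (u v : Fin d) → ¬ u ≡ v → 1 ℕ.< d
      two≤d {suc zero} zero zero u≢v = ⊥-elim (u≢v refl)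
      two≤d {suc (suc d)} u v u≢v = ℕ.s≤s (ℕ.s≤s ℕ.z≤n)

  orientByColour : ∀ {d n} → Rel d → (Fin d → Fin n) → Rel d
  orientByColour adj c u v = adj u v ∧ (toℕ (c u) <ᵇ toℕ (c v))

  module _ {d n} (adj : Rel d) (c : Fin d → Fin n) where

    increasingAlong⇒isProper : ∀ ρ → T (isOrientation adj ρ) → T (increasingAlong ρ c) → T (isProper adj c)
    increasingAlong⇒isProper ρ orient inc = T-allF⁺ λ u → T-allF⁺ λ v →
      T-implies⁺ λ edge → T-not⁺ λ same → distinct u v edge (T-==⁻ same)
      where
      distinct : ∀ u v → T (adj u v) → ¬ c u ≡ c v
      distinct u v edge cu≡cv with T? (ρ u v)
      ... | yes uv = ℕP.<-irrefl (cong toℕ cu≡cv) (increasingAlong⁻ ρ c inc u v uv)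
      ... | no ¬uv = ℕP.<-irrefl (cong toℕ (sym cu≡cv)) (increasingAlong⁻ ρ c inc v u
                       (≡true⇒T (trans (orientation-edge adj ρ orient (T⇒≡true edge)) (cong not (¬T⇒≡false ¬uv)))))

    increasingAlong⇒≗orientByColour : ∀ ρ → T (isOrientation adj ρ) → T (increasingAlong ρ c) →
      ∀ u v → ρ u v ≡ orientByColour adj c u v
    increasingAlong⇒≗orientByColour ρ orient inc u v with adj u v in edge
    ... | false = ¬T⇒≡false (orientation-nonedge adj ρ orient edge)
    ... | true with T? (ρ u v)
    ...   | yes uv = trans (T⇒≡true uv) (sym (T⇒≡true (ℕP.<⇒<ᵇ (increasingAlong⁻ ρ c inc u v uv))))
    ...   | no ¬uv = trans (¬T⇒≡false ¬uv) (sym (¬T⇒≡false λ cu<cv → ℕP.<-asym (ℕP.<ᵇ⇒< _ _ cu<cv)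
                       (increasingAlong⁻ ρ c inc v u (≡true⇒T (trans (orientation-edge adj ρ orient edge) (cong not (¬T⇒≡false ¬uv)))))))

    increasingAlong-orientByColour : T (increasingAlong (orientByColour adj c) c)
    increasingAlong-orientByColour = increasingAlong⁺ (orientByColour adj c) c λ u v t → ℕP.<ᵇ⇒< _ _ (T-∧⁻ʳ {adj u v} t)

    orientByColour-isAcyclicOrientation : (∀ u v → adj u v ≡ adj v u) → T (isProper adj c) →
      T (isAcyclicOrientation adj (orientByColour adj c))
    orientByColour-isAcyclicOrientation symmetric proper = T-∧⁺ orientation acyclic
      where
      toℕ-distinct : ∀ u v → T (adj u v) → ¬ toℕ (c u) ≡ toℕ (c v)
      toℕ-distinct u v edge eq = T-not⁻ (T-implies⁻ (T-allF⁻ (T-allF⁻ proper u) v) edge) (T-==⁺ (FinP.toℕ-injective eq))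
      orientation : T (isOrientation adj (orientByColour adj c))
      orientation = T-allF⁺ λ u → T-allF⁺ λ v → at u v
        where
        at : ∀ u v → T (if adj u v then orientByColour adj c u v xor orientByColour adj c v u
                        else not (orientByColour adj c u v))
        at u v with adj u v in edge
        ... | false = _
        ... | true rewrite trans (symmetric v u) edge with ℕP.<-cmp (toℕ (c u)) (toℕ (c v))
        ...   | tri< lt _ gt rewrite T⇒≡true (ℕP.<⇒<ᵇ lt) | ¬T⇒≡false (gt ∘ ℕP.<ᵇ⇒< _ _) = _
        ...   | tri≈ _ eq _ = ⊥-elim (toℕ-distinct u v (≡true⇒T edge) eq)
        ...   | tri> lt _ gt rewrite ¬T⇒≡false (lt ∘ ℕP.<ᵇ⇒< _ _) | T⇒≡true (ℕP.<⇒<ᵇ gt) = _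
      acyclic : T (isAcyclic (orientByColour adj c))
      acyclic = T-not⁺ λ t →
        let (u , t′) = T-anyF⁻ (λ u → any (λ k → walk (suc k) (orientByColour adj c) u u) (upTo d)) t
            (k , cycle) = T-any-upTo⁻ {d} (λ k → walk (suc k) (orientByColour adj c) u u) t′
        in ℕP.<-irrefl refl (increasingAlong-walk (orientByColour adj c) c increasingAlong-orientByColour k u u cycle)

  walk-cong : ∀ {d} {ρ ρ′ : Rel d} → Pointwise (Pointwise _≡_) ρ ρ′ → ∀ k u v → walk k ρ u v ≡ walk k ρ′ u v
  walk-cong ρ≗ρ′ zero u v = refl
  walk-cong ρ≗ρ′ (suc k) u v = anyF-cong λ w → cong₂ _∧_ (ρ≗ρ′ u w) (walk-cong ρ≗ρ′ k w v)

  isAcyclicOrientation-cong : ∀ {d} (adj : Rel d) {ρ ρ′ : Rel d} → Pointwise (Pointwise _≡_) ρ ρ′ →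
    isAcyclicOrientation adj ρ ≡ isAcyclicOrientation adj ρ′
  isAcyclicOrientation-cong {d} adj ρ≗ρ′ = cong₂ _∧_
    (allF-cong λ u → allF-cong λ v → cong₂ (λ a b → if adj u v then a xor b else not a) (ρ≗ρ′ u v) (ρ≗ρ′ v u))
    (cong not (anyF-cong λ u → any-upTo-cong {d} λ k → walk-cong ρ≗ρ′ (suc k) u u))

  increasingAlong-cong : ∀ {d n} {ρ ρ′ : Rel d} (c : Fin d → Fin n) → Pointwise (Pointwise _≡_) ρ ρ′ →
    increasingAlong ρ c ≡ increasingAlong ρ′ c
  increasingAlong-cong c ρ≗ρ′ = allF-cong λ u → allF-cong λ v → cong (λ a → not a ∨ _) (ρ≗ρ′ u v)

  relations : (d : ℕ) → List (Rel d)
  relations d = allFuns d (allFuns d (true ∷ false ∷ []))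

  relations-enumerate : ∀ d → Enumerates (relations d) (Pointwise (Pointwise _≡_))
  relations-enumerate d =
    allFuns-enumerates (allFuns d (true ∷ false ∷ [])) (λ _ _ → refl)
      (allFuns-enumerates (true ∷ false ∷ []) (λ _ → refl) bools-enumerate d) d

  ∑-increasing : ∀ {d} → Rel d → ℕ → Poly
  ∑-increasing {d} ρ n = ∑[ c ∈ colourings d n ] (if increasingAlong ρ c then qpow (colourWeight c) else [])

  orientationTerm : ∀ {d n} → Rel d → Rel d → (Fin d → Fin n) → Poly
  orientationTerm adj ρ c = if isAcyclicOrientation adj ρ ∧ increasingAlong ρ c then qpow (colourWeight c) else []

  -- A proper colouring c is increasing along exactly one acyclic orientation: orientByColour adj c.
  ∑-orientationTerm : ∀ {d n} (adj : Rel d) → (∀ u v → adj u v ≡ adj v u) → (c : Fin d → Fin n) →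
    ∑[ ρ ∈ relations d ] orientationTerm adj ρ c ≋ (if isProper adj c then qpow (colourWeight c) else [])
  ∑-orientationTerm {d} adj symmetric c with T? (isProper adj c)
  ... | no improper rewrite ¬T⇒≡false improper = ∑-zero (relations d) off
    where
    off : ∀ ρ → orientationTerm adj ρ c ≋ []
    off ρ with isAcyclicOrientation adj ρ ∧ increasingAlong ρ c in t
    ... | false = ≋-refl
    ... | true = ⊥-elim (improper (increasingAlong⇒isProper adj c ρ (T-∧⁻ˡ (T-∧⁻ˡ (≡true⇒T t))) (T-∧⁻ʳ (≡true⇒T t))))
  ... | yes proper rewrite T⇒≡true proper =
    ≋-trans (relations-enumerate d (λ ρ → orientationTerm adj ρ c) ρc off on) at-ρc
    where
    ρc = orientByColour adj c
    off : ∀ ρ → ¬ Pointwise (Pointwise _≡_) ρ ρc → orientationTerm adj ρ c ≋ []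
    off ρ ρ≉ρc with isAcyclicOrientation adj ρ ∧ increasingAlong ρ c in t
    ... | false = ≋-refl
    ... | true = ⊥-elim (ρ≉ρc (increasingAlong⇒≗orientByColour adj c ρ (T-∧⁻ˡ (T-∧⁻ˡ (≡true⇒T t))) (T-∧⁻ʳ (≡true⇒T t))))
    on : ∀ ρ → Pointwise (Pointwise _≡_) ρ ρc → orientationTerm adj ρ c ≋ orientationTerm adj ρc c
    on ρ ρ≗ρc = ≋-reflexive (cong (λ b → if b then qpow (colourWeight c) else [])
      (cong₂ _∧_ (isAcyclicOrientation-cong adj ρ≗ρc) (increasingAlong-cong c ρ≗ρc)))
    at-ρc : orientationTerm adj ρc c ≋ qpow (colourWeight c)
    at-ρc rewrite T⇒≡true (orientByColour-isAcyclicOrientation adj c symmetric proper)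
                | T⇒≡true (increasingAlong-orientByColour adj c) = ≋-refl

  chi≋∑-acyclicOrientations : ∀ {d} (adj : Rel d) → (∀ u v → adj u v ≡ adj v u) → ∀ n →
    chi adj n ≋ ∑[ ρ ∈ relations d ] (if isAcyclicOrientation adj ρ then ∑-increasing ρ n else [])
  chi≋∑-acyclicOrientations {d} adj symmetric n = ≋-sym (begin
    ∑[ ρ ∈ relations d ] (if isAcyclicOrientation adj ρ then ∑-increasing ρ n else [])
      ≈⟨ ∑-cong (relations d) (λ ρ → ≋-trans (∑-if (colourings d n) (isAcyclicOrientation adj ρ) _)
                                              (∑-cong (colourings d n) (λ c → ≋-reflexive (if-∧ ρ c)))) ⟩
    ∑[ ρ ∈ relations d ] ∑[ c ∈ colourings d n ] orientationTerm adj ρ c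
      ≈⟨ ∑-comm (relations d) (colourings d n) (orientationTerm adj) ⟩
    ∑[ c ∈ colourings d n ] ∑[ ρ ∈ relations d ] orientationTerm adj ρ c
      ≈⟨ ∑-cong (colourings d n) (∑-orientationTerm adj symmetric) ⟩
    ∑[ c ∈ colourings d n ] (if isProper adj c then qpow (colourWeight c) else [])  ∎)
    where
    open ≋-Reasoning
    if-∧ : ∀ ρ c → (if isAcyclicOrientation adj ρ then (if increasingAlong ρ c then qpow (colourWeight c) else []) else [])
                   ≡ orientationTerm adj ρ c
    if-∧ ρ c with isAcyclicOrientation adj ρ
    ... | true = refl
    ... | false = refl

module FinEndo where

  injective⇒surjective : ∀ {d} {f : Fin d → Fin d} → Injective _≡_ _≡_ f → ∀ i → Σ (Fin d) λ j → f j ≡ i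
  injective⇒surjective {suc d} {f} f-injective i with FinP.any? (λ j → f j FinP.≟ i)
  ... | yes hit = hit
  ... | no miss = ⊥-elim (ℕP.<-irrefl refl (FinP.injective⇒≤ punchOut-injective))
    where
    i≢f : ∀ j → ¬ i ≡ f j
    i≢f j i≡fj = miss (j , sym i≡fj)
    punchOut-injective : Injective _≡_ _≡_ (λ j → Fin.punchOut (i≢f j))
    punchOut-injective eq = f-injective (FinP.punchOut-injective (i≢f _) (i≢f _) eq)

  module Inverse {d} (f : Fin d → Fin d) (f-injective : Injective _≡_ _≡_ f) where

    f⁻¹ : Fin d → Fin d
    f⁻¹ = proj₁ ∘ injective⇒surjective f-injective

    inverseʳ : ∀ i → f (f⁻¹ i) ≡ i
    inverseʳ = proj₂ ∘ injective⇒surjective f-injective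

    inverseˡ : ∀ v → f⁻¹ (f v) ≡ v
    inverseˡ v = f-injective (inverseʳ (f v))

    f⁻¹-injective : Injective _≡_ _≡_ f⁻¹
    f⁻¹-injective {a} {b} eq = trans (sym (inverseʳ a)) (trans (cong f eq) (inverseʳ b))

module Counting where

  open ListSum ℕP.+-0-commutativeMonoid public using (∑; ∑-cong; ∑-allFin-suc; ∑-permute)

  ∑-mono-≤ : ∀ d {g h : Fin d → ℕ} → (∀ i → g i ℕ.≤ h i) → ∑ (allFin d) g ℕ.≤ ∑ (allFin d) h
  ∑-mono-≤ zero g≤h = ℕ.z≤n
  ∑-mono-≤ (suc d) {g} {h} g≤h rewrite ∑-allFin-suc d g | ∑-allFin-suc d h =
    ℕP.+-mono-≤ (g≤h zero) (∑-mono-≤ d (g≤h ∘ suc))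

  ∑-mono-< : ∀ d {g h : Fin d → ℕ} → (∀ i → g i ℕ.≤ h i) → ∀ i₀ → g i₀ ℕ.< h i₀ → ∑ (allFin d) g ℕ.< ∑ (allFin d) h
  ∑-mono-< (suc d) {g} {h} g≤h i₀ g<h rewrite ∑-allFin-suc d g | ∑-allFin-suc d h with i₀
  ... | zero = ℕP.+-mono-<-≤ g<h (∑-mono-≤ d (g≤h ∘ suc))
  ... | suc i₀ = ℕP.+-mono-≤-< (g≤h zero) (∑-mono-< d (g≤h ∘ suc) i₀ g<h)

  ∑-const-1 : ∀ d → ∑ (allFin d) (const 1) ≡ d
  ∑-const-1 zero = refl
  ∑-const-1 (suc d) = trans (∑-allFin-suc d (const 1)) (cong suc (∑-const-1 d))

  count-< : ∀ d k → k ℕ.≤ d → ∑ (allFin d) (λ j → if toℕ j <ᵇ k then 1 else 0) ≡ k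
  count-< zero zero _ = refl
  count-< (suc d) zero _ = trans (∑-allFin-suc d (λ j → if toℕ j <ᵇ 0 then 1 else 0)) (count-< d 0 ℕ.z≤n)
  count-< (suc d) (suc k) (ℕ.s≤s k≤d) =
    trans (∑-allFin-suc d (λ j → if toℕ j <ᵇ suc k then 1 else 0)) (cong suc (count-< d k k≤d))

module Sorting {d} {_≺_ : Fin d → Fin d → Set} (≺-isStrictTotalOrder : IsStrictTotalOrder _≡_ _≺_) where

  open IsStrictTotalOrder ≺-isStrictTotalOrder using (compare; _<?_; irrefl; asym) renaming (trans to ≺-trans)
  open Counting
  open BoolView using (T⇒≡true; ¬T⇒≡false)

  below? : Fin d → Fin d → ℕ
  below? u v = if does (u <? v) then 1 else 0

  below?-≺ : ∀ {u v} → u ≺ v → below? u v ≡ 1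
  below?-≺ {u} {v} u≺v rewrite dec-true (u <? v) u≺v = refl

  below?-⊀ : ∀ {u v} → ¬ u ≺ v → below? u v ≡ 0
  below?-⊀ {u} {v} u⊀v rewrite dec-false (u <? v) u⊀v = refl

  below?≤1 : ∀ u v → below? u v ℕ.≤ 1
  below?≤1 u v with does (u <? v)
  ... | true = ℕP.≤-refl
  ... | false = ℕ.z≤n

  rank : Fin d → ℕ
  rank v = ∑ (allFin d) (λ u → below? u v)

  rank-mono : ∀ {u v} → u ≺ v → rank u ℕ.< rank v
  rank-mono {u} {v} u≺v = ∑-mono-< d pointwise u
    (subst₂ ℕ._<_ (sym (below?-⊀ (irrefl refl))) (sym (below?-≺ u≺v)) ℕ.z<s)
    where
    pointwise : ∀ w → below? w u ℕ.≤ below? w v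
    pointwise w with w <? u
    ... | yes w≺u = ℕP.≤-reflexive (sym (below?-≺ (≺-trans w≺u u≺v)))
    ... | no _ = ℕ.z≤n

  rank<d : ∀ v → rank v ℕ.< d
  rank<d v = subst (rank v ℕ.<_) (∑-const-1 d)
    (∑-mono-< d (λ u → below?≤1 u v) v (subst (ℕ._< 1) (sym (below?-⊀ (irrefl refl))) ℕ.z<s))

  rankFin : Fin d → Fin d
  rankFin v = Fin.fromℕ< (rank<d v)

  toℕ-rankFin : ∀ v → toℕ (rankFin v) ≡ rank v
  toℕ-rankFin v = FinP.toℕ-fromℕ< (rank<d v)

  same-rank : ∀ {u v} → rankFin u ≡ rankFin v → rank u ≡ rank v
  same-rank {u} {v} eq = trans (sym (toℕ-rankFin u)) (trans (cong toℕ eq) (toℕ-rankFin v))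

  rankFin-injective : Injective _≡_ _≡_ rankFin
  rankFin-injective {u} {v} eq with compare u v
  ... | tri< u≺v _ _ = ⊥-elim (ℕP.<-irrefl (same-rank eq) (rank-mono u≺v))
  ... | tri≈ _ u≡v _ = u≡v
  ... | tri> _ _ v≺u = ⊥-elim (ℕP.<-irrefl (same-rank (sym eq)) (rank-mono v≺u))



  open FinEndo.Inverse rankFin rankFin-injective public
    using () renaming (f⁻¹ to sorted; inverseʳ to rankFin-sorted; inverseˡ to sorted-rankFin; f⁻¹-injective to sorted-injective)

  rank-sorted : ∀ i → rank (sorted i) ≡ toℕ i
  rank-sorted i = trans (sym (toℕ-rankFin (sorted i))) (cong toℕ (rankFin-sorted i))

  sorted-increasing : ∀ i j → toℕ i ℕ.< toℕ j → sorted i ≺ sorted j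
  sorted-increasing i j i<j with compare (sorted i) (sorted j)
  ... | tri< lt _ _ = lt
  ... | tri≈ _ eq _ = ⊥-elim (ℕP.<-irrefl (trans (sym (rank-sorted i)) (trans (cong rank eq) (rank-sorted j))) i<j)
  ... | tri> _ _ gt = ⊥-elim (ℕP.<-asym i<j (subst₂ ℕ._<_ (rank-sorted j) (rank-sorted i) (rank-mono gt)))

  -- A bijection y listing Fin d in ≺-increasing order has rank (y i) = i, hence y = sorted.
  increasing⇒≗sorted : ∀ (y y⁻¹ : Fin d → Fin d) → (∀ i → y⁻¹ (y i) ≡ i) → (∀ v → y (y⁻¹ v) ≡ v) →
    (∀ i j → toℕ i ℕ.< toℕ j → y i ≺ y j) → ∀ i → y i ≡ sorted i
  increasing⇒≗sorted y y⁻¹ y⁻¹y yy⁻¹ increasing i =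
    trans (sym (sorted-rankFin (y i))) (cong sorted (FinP.toℕ-injective (trans (toℕ-rankFin (y i)) rank-y)))
    where
    below?-y : ∀ j → below? (y j) (y i) ≡ (if toℕ j <ᵇ toℕ i then 1 else 0)
    below?-y j with ℕP.<-cmp (toℕ j) (toℕ i)
    ... | tri< j<i _ _ rewrite T⇒≡true (ℕP.<⇒<ᵇ j<i) = below?-≺ (increasing j i j<i)
    ... | tri≈ _ j≡i _ rewrite ¬T⇒≡false (ℕP.<-irrefl j≡i ∘ ℕP.<ᵇ⇒< _ _) | FinP.toℕ-injective j≡i = below?-⊀ (irrefl refl)
    ... | tri> _ _ i<j rewrite ¬T⇒≡false (ℕP.<-asym i<j ∘ ℕP.<ᵇ⇒< _ _) = below?-⊀ (asym (increasing i j i<j))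
    rank-y : rank (y i) ≡ toℕ i
    rank-y = begin
      rank (y i)                                            ≡⟨ ∑-permute d y y⁻¹ y⁻¹y yy⁻¹ (λ u → below? u (y i)) ⟨
      ∑ (allFin d) (λ j → below? (y j) (y i))               ≡⟨ ∑-cong (allFin d) below?-y ⟩
      ∑ (allFin d) (λ j → if toℕ j <ᵇ toℕ i then 1 else 0)  ≡⟨ count-< d (toℕ i) (ℕP.<⇒≤ (FinP.toℕ<n i)) ⟩
      toℕ i                                                 ∎
      where open ≡-Reasoning

module Words where

  open QPoly using (∑)
  open BoolView
  open Colourings using (colourings)

  bit : Bool → ℕ
  bit true = 1
  bit false = 0

  _≤[_]ᵇ_ : ℕ → Bool → ℕ → Bool
  a ≤[ b ]ᵇ c = (a ℕ.+ bit b) ℕ.≤ᵇ c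

  compatibleFrom : ∀ {d n} → ℕ → List Bool → (Fin d → Fin n) → Bool
  compatibleFrom {zero} L bs f = true
  compatibleFrom {suc d} L [] f = true
  compatibleFrom {suc d} L (b ∷ bs) f = (L ≤[ b ]ᵇ toℕ (f zero)) ∧ compatibleFrom (toℕ (f zero)) bs (f ∘ suc)

  strictCount : List Bool → ℕ
  strictCount [] = 0
  strictCount (b ∷ bs) = bit b ℕ.+ strictCount bs

  strictWeight : List Bool → ℕ
  strictWeight [] = 0
  strictWeight (b ∷ bs) = bit b ℕ.* suc (length bs) ℕ.+ strictWeight bs

  strictCount≤length : ∀ bs → strictCount bs ℕ.≤ length bs
  strictCount≤length [] = ℕ.z≤n
  strictCount≤length (true ∷ bs) = ℕ.s≤s (strictCount≤length bs)
  strictCount≤length (false ∷ bs) = ℕP.m≤n⇒m≤1+n (strictCount≤length bs)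

  ascentWord : ∀ {d} → (Fin (suc d) → ℕ) → List Bool
  ascentWord {zero} σ = []
  ascentWord {suc d} σ = (σ zero <ᵇ σ (suc zero)) ∷ ascentWord (σ ∘ suc)

  strictWord : ∀ {d} → (Fin d → ℕ) → List Bool
  strictWord {zero} σ = []
  strictWord {suc d} σ = false ∷ ascentWord σ

  length-ascentWord : ∀ {d} (σ : Fin (suc d) → ℕ) → length (ascentWord σ) ≡ d
  length-ascentWord {zero} σ = refl
  length-ascentWord {suc d} σ = cong suc (length-ascentWord (σ ∘ suc))

  length-strictWord : ∀ {d} (σ : Fin d → ℕ) → length (strictWord σ) ≡ d
  length-strictWord {zero} σ = refl
  length-strictWord {suc d} σ = cong suc (length-ascentWord σ)

  compatible : ∀ {d n} → (Fin d → ℕ) → (Fin d → Fin n) → Bool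
  compatible σ f = compatibleFrom 0 (strictWord σ) f

  Compatible : ∀ {d n} → (Fin d → ℕ) → (Fin d → Fin n) → Set
  Compatible σ f = ∀ i j → toℕ i ℕ.< toℕ j → toℕ (f i) ℕ.< toℕ (f j) ⊎ (toℕ (f i) ≡ toℕ (f j) × σ j ℕ.≤ σ i)

  T-≤[]ᵇ⁻ : ∀ b a c → T (a ≤[ b ]ᵇ c) → a ℕ.< c ⊎ (a ≡ c × b ≡ false)
  T-≤[]ᵇ⁻ true a c t = inj₁ (subst (ℕ._≤ c) (ℕP.+-comm a 1) (ℕP.≤ᵇ⇒≤ _ _ t))
  T-≤[]ᵇ⁻ false a c t with ℕP.m≤n⇒m<n∨m≡n (subst (ℕ._≤ c) (ℕP.+-identityʳ a) (ℕP.≤ᵇ⇒≤ _ _ t))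
  ... | inj₁ a<c = inj₁ a<c
  ... | inj₂ a≡c = inj₂ (a≡c , refl)

  T-≤[]ᵇ⁺ : ∀ b a c → a ℕ.< c ⊎ (a ≡ c × b ≡ false) → T (a ≤[ b ]ᵇ c)
  T-≤[]ᵇ⁺ true a c (inj₁ a<c) = ℕP.≤⇒≤ᵇ (subst (ℕ._≤ c) (ℕP.+-comm 1 a) a<c)
  T-≤[]ᵇ⁺ false a c (inj₁ a<c) = ℕP.≤⇒≤ᵇ (subst (ℕ._≤ c) (sym (ℕP.+-identityʳ a)) (ℕP.<⇒≤ a<c))
  T-≤[]ᵇ⁺ false a c (inj₂ (a≡c , _)) = ℕP.≤⇒≤ᵇ (subst (ℕ._≤ c) (sym (ℕP.+-identityʳ a)) (ℕP.≤-reflexive a≡c))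

  compatible⇒Compatible-step : ∀ s₀ s₁ f₀ f₁ → T (f₀ ≤[ s₀ <ᵇ s₁ ]ᵇ f₁) → f₀ ℕ.< f₁ ⊎ (f₀ ≡ f₁ × s₁ ℕ.≤ s₀)
  compatible⇒Compatible-step s₀ s₁ f₀ f₁ t with T-≤[]ᵇ⁻ (s₀ <ᵇ s₁) f₀ f₁ t
  ... | inj₁ f₀<f₁ = inj₁ f₀<f₁
  ... | inj₂ (f₀≡f₁ , no-ascent) = inj₂ (f₀≡f₁ , ℕP.≮⇒≥ (λ s₀<s₁ → subst T no-ascent (ℕP.<⇒<ᵇ s₀<s₁)))

  private
    compatibleTail : ∀ {d n} (σ : Fin (suc d) → ℕ) (f : Fin (suc d) → Fin n) → Bool
    compatibleTail σ f = compatibleFrom (toℕ (f zero)) (ascentWord σ) (f ∘ suc)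

    compatibleTail⇒Compatible : ∀ {d n} (σ : Fin (suc d) → ℕ) (f : Fin (suc d) → Fin n) →
      T (compatibleTail σ f) → Compatible σ f
    compatibleTail⇒Compatible {zero} σ f t zero zero ()
    compatibleTail⇒Compatible {suc d} σ f t = go
      where
      first : toℕ (f zero) ℕ.< toℕ (f (suc zero)) ⊎ (toℕ (f zero) ≡ toℕ (f (suc zero)) × σ (suc zero) ℕ.≤ σ zero)
      first = compatible⇒Compatible-step (σ zero) (σ (suc zero)) (toℕ (f zero)) (toℕ (f (suc zero))) (T-∧⁻ˡ t)
      rest : Compatible (σ ∘ suc) (f ∘ suc)
      rest = compatibleTail⇒Compatible (σ ∘ suc) (f ∘ suc) (T-∧⁻ʳ t)
      go : Compatible σ f
      go zero (suc zero) _ = first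
      go zero (suc (suc j)) _ with first | rest zero (suc j) ℕ.z<s
      ... | inj₁ a | inj₁ b = inj₁ (ℕP.<-trans a b)
      ... | inj₁ a | inj₂ (e , _) = inj₁ (subst (toℕ (f zero) ℕ.<_) e a)
      ... | inj₂ (e , _) | inj₁ b = inj₁ (subst (ℕ._< toℕ (f (suc (suc j)))) (sym e) b)
      ... | inj₂ (e , s) | inj₂ (e′ , s′) = inj₂ (trans e e′ , ℕP.≤-trans s′ s)
      go (suc i) (suc j) (ℕ.s<s i<j) = rest i j i<j

    Compatible⇒compatibleTail : ∀ {d n} (σ : Fin (suc d) → ℕ) (f : Fin (suc d) → Fin n) →
      Compatible σ f → T (compatibleTail σ f)
    Compatible⇒compatibleTail {zero} σ f _ = _
    Compatible⇒compatibleTail {suc d} σ f compat =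
      T-∧⁺ (T-≤[]ᵇ⁺ (σ zero <ᵇ σ (suc zero)) _ _ first)
           (Compatible⇒compatibleTail (σ ∘ suc) (f ∘ suc) λ i j i<j → compat (suc i) (suc j) (ℕ.s<s i<j))
      where
      first : toℕ (f zero) ℕ.< toℕ (f (suc zero)) ⊎ (toℕ (f zero) ≡ toℕ (f (suc zero)) × (σ zero <ᵇ σ (suc zero)) ≡ false)
      first with compat zero (suc zero) ℕ.z<s
      ... | inj₁ lt = inj₁ lt
      ... | inj₂ (e , s) = inj₂ (e , ¬T⇒≡false (λ t → ℕP.<-irrefl refl (ℕP.<-≤-trans (ℕP.<ᵇ⇒< _ _ t) s)))

  compatible⇒Compatible : ∀ {d n} (σ : Fin d → ℕ) (f : Fin d → Fin n) → T (compatible σ f) → Compatible σ f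
  compatible⇒Compatible {zero} σ f t ()
  compatible⇒Compatible {suc d} σ f t = compatibleTail⇒Compatible σ f t

  Compatible⇒compatible : ∀ {d n} (σ : Fin d → ℕ) (f : Fin d → Fin n) → Compatible σ f → T (compatible σ f)
  Compatible⇒compatible {zero} σ f _ = _
  Compatible⇒compatible {suc d} σ f compat = Compatible⇒compatibleTail σ f compat

  compatibleFrom-cong : ∀ {d n} L bs {f g : Fin d → Fin n} → (∀ i → f i ≡ g i) → compatibleFrom L bs f ≡ compatibleFrom L bs g
  compatibleFrom-cong {zero} L bs f≗g = refl
  compatibleFrom-cong {suc d} L [] f≗g = refl
  compatibleFrom-cong {suc d} L (b ∷ bs) {f} {g} f≗g rewrite f≗g zero =
    cong (_ ∧_) (compatibleFrom-cong (toℕ (g zero)) bs (f≗g ∘ suc))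

  ascentWord-cong : ∀ {d} {σ σ′ : Fin (suc d) → ℕ} → (∀ i → σ i ≡ σ′ i) → ascentWord σ ≡ ascentWord σ′
  ascentWord-cong {zero} σ≗σ′ = refl
  ascentWord-cong {suc d} σ≗σ′ = cong₂ _∷_ (cong₂ _<ᵇ_ (σ≗σ′ zero) (σ≗σ′ (suc zero))) (ascentWord-cong (σ≗σ′ ∘ suc))

  strictWord-cong : ∀ {d} {σ σ′ : Fin d → ℕ} → (∀ i → σ i ≡ σ′ i) → strictWord σ ≡ strictWord σ′
  strictWord-cong {zero} σ≗σ′ = refl
  strictWord-cong {suc d} σ≗σ′ = cong (false ∷_) (ascentWord-cong σ≗σ′)

  compatible-cong : ∀ {d n} {σ σ′ : Fin d → ℕ} {f g : Fin d → Fin n} →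
    (∀ i → σ i ≡ σ′ i) → (∀ i → f i ≡ g i) → compatible σ f ≡ compatible σ′ g
  compatible-cong {σ′ = σ′} {f} σ≗σ′ f≗g =
    trans (cong (λ bs → compatibleFrom 0 bs f) (strictWord-cong σ≗σ′)) (compatibleFrom-cong 0 (strictWord σ′) f≗g)

  colourWeight-cong : ∀ {d n} {c c′ : Fin d → Fin n} → (∀ i → c i ≡ c′ i) → colourWeight c ≡ colourWeight c′
  colourWeight-cong c≗c′ = cong sum (map-cong (λ v → cong (suc ∘ toℕ) (c≗c′ v)) (allFin _))

  colourWeight-∘ : ∀ {d n} (c : Fin d → Fin n) (y y⁻¹ : Fin d → Fin d) → (∀ i → y⁻¹ (y i) ≡ i) → (∀ v → y (y⁻¹ v) ≡ v) →
    colourWeight (c ∘ y) ≡ colourWeight c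
  colourWeight-∘ {d} c y y⁻¹ y⁻¹y yy⁻¹ = Counting.∑-permute d y y⁻¹ y⁻¹y yy⁻¹ (suc ∘ toℕ ∘ c)

  colourWeight-∷ : ∀ {d n} (v : Fin n) (g : Fin d → Fin n) → colourWeight (v ∷ᶠ g) ≡ suc (toℕ v) ℕ.+ colourWeight g
  colourWeight-∷ {d} v g = cong (λ xs → suc (toℕ v) ℕ.+ sum xs)
    (trans (map-tabulate suc (suc ∘ toℕ ∘ (v ∷ᶠ g))) (sym (map-tabulate id (suc ∘ toℕ ∘ g))))

  ∑-compatible : ∀ {d} → (Fin d → ℕ) → ℕ → Poly
  ∑-compatible {d} σ n = ∑[ f ∈ colourings d n ] (if compatible σ f then qpow (colourWeight f) else [])

  triangular : ℕ → ℕ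
  triangular zero = 0
  triangular (suc k) = k ℕ.+ triangular k

  triangularFrom : ℕ → ℕ → ℕ
  triangularFrom j zero = 0
  triangularFrom j (suc k) = j ℕ.+ triangularFrom (suc j) k

  triangularFrom-suc : ∀ j k → triangularFrom j (suc k) ≡ triangularFrom j k ℕ.+ (j ℕ.+ k)
  triangularFrom-suc j zero = refl
  triangularFrom-suc j (suc k) = trans (cong (j ℕ.+_) (triangularFrom-suc (suc j) k)) (regroup j (triangularFrom (suc j) k) k)
    where
    regroup : ∀ j t k → j ℕ.+ (t ℕ.+ (suc j ℕ.+ k)) ≡ j ℕ.+ t ℕ.+ (j ℕ.+ suc k)
    regroup = solveℕ

  triangular≡triangularFrom0 : ∀ k → triangular k ≡ triangularFrom 0 k
  triangular≡triangularFrom0 zero = refl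
  triangular≡triangularFrom0 (suc k) =
    trans (cong (k ℕ.+_) (triangular≡triangularFrom0 k)) (trans (ℕP.+-comm k _) (sym (triangularFrom-suc 0 k)))

  map-allFin-suc : ∀ {d} (σ : Fin (suc d) → ℕ) → map σ (allFin (suc d)) ≡ σ zero ∷ map (σ ∘ suc) (allFin d)
  map-allFin-suc σ = cong (σ zero ∷_) (trans (map-tabulate suc σ) (sym (map-tabulate id (σ ∘ suc))))

  strictWeight-ascentWord : ∀ d (σ : Fin (suc d) → ℕ) → Injective _≡_ _≡_ σ → ∀ j →
    strictWeight (ascentWord σ) ℕ.+ triangularFrom j d ≡ strictCount (ascentWord σ) ℕ.* (j ℕ.+ d) ℕ.+ majFrom j (map σ (allFin (suc d)))
  strictWeight-ascentWord zero σ _ j = sym (ℕP.*-zeroˡ (j ℕ.+ 0))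
  strictWeight-ascentWord (suc d) σ σ-injective j =
    trans (cong (λ l → bit ascent ℕ.* suc l ℕ.+ E ℕ.+ (j ℕ.+ triangularFrom (suc j) d)) (length-ascentWord (σ ∘ suc)))
      (trans step (cong ((bit ascent ℕ.+ c) ℕ.* (j ℕ.+ suc d) ℕ.+_) (sym majFrom-split)))
    where
    ascent = σ zero <ᵇ σ (suc zero)
    descent = σ (suc zero) <ᵇ σ zero
    E = strictWeight (ascentWord (σ ∘ suc))
    c = strictCount (ascentWord (σ ∘ suc))
    M = majFrom (suc j) (map (σ ∘ suc) (allFin (suc d)))
    IH : E ℕ.+ triangularFrom (suc j) d ≡ c ℕ.* (suc j ℕ.+ d) ℕ.+ M
    IH = strictWeight-ascentWord d (σ ∘ suc) (FinP.suc-injective ∘ σ-injective) (suc j)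
    majFrom-split : majFrom j (map σ (allFin (suc (suc d)))) ≡ (if descent then j else 0) ℕ.+ M
    majFrom-split = trans (cong (majFrom j) (trans (map-allFin-suc σ) (cong (σ zero ∷_) (map-allFin-suc (σ ∘ suc)))))
                          (cong (λ w → (if descent then j else 0) ℕ.+ majFrom (suc j) w) (sym (map-allFin-suc (σ ∘ suc))))
    step : bit ascent ℕ.* suc d ℕ.+ E ℕ.+ (j ℕ.+ triangularFrom (suc j) d)
         ≡ (bit ascent ℕ.+ c) ℕ.* (j ℕ.+ suc d) ℕ.+ ((if descent then j else 0) ℕ.+ M)
    step with ℕP.<-cmp (σ zero) (σ (suc zero))
    ... | tri< lt _ gt rewrite T⇒≡true (ℕP.<⇒<ᵇ lt) | ¬T⇒≡false (gt ∘ ℕP.<ᵇ⇒< _ _) =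
          trans (regroup₁ d E j (triangularFrom (suc j) d)) (trans (cong (suc d ℕ.+ j ℕ.+_) IH) (regroup₂ d j c M))
      where
      regroup₁ : ∀ d E j t → 1 ℕ.* suc d ℕ.+ E ℕ.+ (j ℕ.+ t) ≡ suc d ℕ.+ j ℕ.+ (E ℕ.+ t)
      regroup₁ = solveℕ
      regroup₂ : ∀ d j c M → suc d ℕ.+ j ℕ.+ (c ℕ.* (suc j ℕ.+ d) ℕ.+ M) ≡ (1 ℕ.+ c) ℕ.* (j ℕ.+ suc d) ℕ.+ (0 ℕ.+ M)
      regroup₂ = solveℕ
    ... | tri≈ _ eq _ = ⊥-elim (0≢1 (σ-injective eq))
      where
      0≢1 : ¬ zero ≡ Fin.suc (zero {d})
      0≢1 ()
    ... | tri> lt _ gt rewrite ¬T⇒≡false (lt ∘ ℕP.<ᵇ⇒< _ _) | T⇒≡true (ℕP.<⇒<ᵇ gt) =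
          trans (regroup₁ d E j (triangularFrom (suc j) d)) (trans (cong (j ℕ.+_) IH) (regroup₂ d j c M))
      where
      regroup₁ : ∀ d E j t → 0 ℕ.* suc d ℕ.+ E ℕ.+ (j ℕ.+ t) ≡ j ℕ.+ (E ℕ.+ t)
      regroup₁ = solveℕ
      regroup₂ : ∀ d j c M → j ℕ.+ (c ℕ.* (suc j ℕ.+ d) ℕ.+ M) ≡ (0 ℕ.+ c) ℕ.* (j ℕ.+ suc d) ℕ.+ (j ℕ.+ M)
      regroup₂ = solveℕ

  strictWeight+triangular : ∀ d (σ : Fin d → ℕ) → Injective _≡_ _≡_ σ →
    strictWeight (strictWord σ) ℕ.+ triangular d ≡ strictCount (strictWord σ) ℕ.* d ℕ.+ majFrom 1 (map σ (allFin d))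
  strictWeight+triangular zero σ _ = refl
  strictWeight+triangular (suc d) σ σ-injective =
    trans (cong (strictWeight (ascentWord σ) ℕ.+_) (triangular≡triangularFrom0 (suc d))) (strictWeight-ascentWord d σ σ-injective 1)

module PPartitions {d} (adj : Rel d) (loopless : ∀ u → adj u u ≡ false)
                   (ρ : Rel d) (orient : T (isOrientation adj ρ))
                   (ω : Fin d → Fin d) (natural : IsNaturalLabeling ρ ω) where

  open QPoly
  open BoolView
  open Colourings
  open Orientations
  open Words

  ω-injective : Injective _≡_ _≡_ ω
  ω-injective = proj₁ natural

  ω-mono : ∀ u v → T (below ρ u v) → toℕ (ω u) ℕ.< toℕ (ω v)
  ω-mono = proj₂ (proj₂ natural)

  arc⇒below′ : ∀ u v → T (ρ u v) → T (below ρ u v)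
  arc⇒below′ = arc⇒below adj ρ orient loopless

  IsLinearExtension : (Fin d → Fin d) → Set
  IsLinearExtension y = Injective _≡_ _≡_ y × (∀ i j → T (below ρ (y i) (y j)) → toℕ i ℕ.< toℕ j)

  isLinearExtension⁻ : ∀ y → T (isLinearExtension ρ y) → IsLinearExtension y
  isLinearExtension⁻ y t =
    (λ {i} {j} yi≡yj → T-==⁻ {i = i} {j} (T-implies⁻ (T-allF⁻ (T-allF⁻ (T-∧⁻ˡ t) i) j) (T-==⁺ yi≡yj))) ,
    (λ i j yi<yj → ℕP.<ᵇ⇒< _ _ (T-implies⁻ (T-allF⁻ (T-allF⁻ (T-∧⁻ʳ t) i) j) yi<yj))

  isLinearExtension⁺ : ∀ y → IsLinearExtension y → T (isLinearExtension ρ y)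
  isLinearExtension⁺ y (y-injective , y-ordered) = T-∧⁺
    (T-allF⁺ λ i → T-allF⁺ λ j → T-implies⁺ λ t → T-==⁺ (y-injective (T-==⁻ {i = y i} {y j} t)))
    (T-allF⁺ λ i → T-allF⁺ λ j → T-implies⁺ (ℕP.<⇒<ᵇ ∘ y-ordered i j))

  isLinearExtension-cong : ∀ {y y′} → (∀ i → y i ≡ y′ i) → isLinearExtension ρ y ≡ isLinearExtension ρ y′
  isLinearExtension-cong y≗y′ = cong₂ _∧_
    (allF-cong λ i → allF-cong λ j → cong (λ z → not z ∨ (i == j)) (cong₂ _==_ (y≗y′ i) (y≗y′ j)))
    (allF-cong λ i → allF-cong λ j → cong (λ z → not z ∨ (toℕ i <ᵇ toℕ j)) (cong₂ (below ρ) (y≗y′ i) (y≗y′ j)))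

  -- Ties in colour are broken by decreasing label, so a colour can repeat only along a descent.
  module ColourOrder {n} (c : Fin d → Fin n) where

    _◁_ : Fin d → Fin d → Set
    u ◁ v = toℕ (c u) ℕ.< toℕ (c v) ⊎ (toℕ (c u) ≡ toℕ (c v) × toℕ (ω v) ℕ.< toℕ (ω u))

    ◁-irrefl : ∀ {u v} → u ≡ v → ¬ u ◁ v
    ◁-irrefl refl (inj₁ lt) = ℕP.<-irrefl refl lt
    ◁-irrefl refl (inj₂ (_ , lt)) = ℕP.<-irrefl refl lt

    ◁-trans : ∀ {u v w} → u ◁ v → v ◁ w → u ◁ w
    ◁-trans (inj₁ a) (inj₁ b) = inj₁ (ℕP.<-trans a b)
    ◁-trans {u} (inj₁ a) (inj₂ (e , _)) = inj₁ (subst (toℕ (c u) ℕ.<_) e a)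
    ◁-trans {w = w} (inj₂ (e , _)) (inj₁ b) = inj₁ (subst (ℕ._< toℕ (c w)) (sym e) b)
    ◁-trans (inj₂ (e , a)) (inj₂ (e′ , b)) = inj₂ (trans e e′ , ℕP.<-trans b a)

    ◁-compare : Trichotomous _≡_ _◁_
    ◁-compare u v with ℕP.<-cmp (toℕ (c u)) (toℕ (c v))
    ... | tri< a ¬b ¬c = tri< (inj₁ a) (λ { refl → ¬b refl }) [ ¬c , ¬b ∘ sym ∘ proj₁ ]′
    ... | tri> ¬a ¬b c′ = tri> [ ¬a , ¬b ∘ proj₁ ]′ (λ { refl → ¬b refl }) (inj₁ c′)
    ... | tri≈ ¬a e ¬c with ℕP.<-cmp (toℕ (ω u)) (toℕ (ω v))
    ...   | tri< a′ ¬b′ ¬c′ = tri> [ ¬a , ¬c′ ∘ proj₂ ]′ (λ { refl → ¬b′ refl }) (inj₂ (sym e , a′))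
    ...   | tri> ¬a′ ¬b′ c′ = tri< (inj₂ (e , c′)) (λ { refl → ¬b′ refl }) [ ¬c , ¬a′ ∘ proj₂ ]′
    ...   | tri≈ _ e′ _ = tri≈ [ ¬a , (λ { (_ , lt) → ℕP.<-irrefl (sym e′) lt }) ]′ (ω-injective (FinP.toℕ-injective e′))
                               [ ¬c , (λ { (_ , lt) → ℕP.<-irrefl e′ lt }) ]′

    ◁-isStrictTotalOrder : IsStrictTotalOrder _≡_ _◁_
    ◁-isStrictTotalOrder = record
      { isStrictPartialOrder = record
        { isEquivalence = ≡-isEquivalence
        ; irrefl = ◁-irrefl
        ; trans = ◁-trans
        ; <-resp-≈ = (λ { refl u◁v → u◁v }) , (λ { refl u◁v → u◁v }) }
      ; compare = ◁-compare }

    open Sorting ◁-isStrictTotalOrder public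

  labelsAlong : (Fin d → Fin d) → Fin d → ℕ
  labelsAlong y = toℕ ∘ ω ∘ y

  module _ {n} (c : Fin d → Fin n) where

    open ColourOrder c

    compatibleListing⇒increasingAlong : ∀ y → IsLinearExtension y → Compatible (labelsAlong y) (c ∘ y) →
      T (increasingAlong ρ c)
    compatibleListing⇒increasingAlong y (y-injective , y-ordered) compat = increasingAlong⁺ ρ c arc
      where
      open FinEndo.Inverse y y-injective
      arc : ∀ u v → T (ρ u v) → toℕ (c u) ℕ.< toℕ (c v)
      arc u v uv with compat (f⁻¹ u) (f⁻¹ v) (y-ordered (f⁻¹ u) (f⁻¹ v)
                        (subst₂ (λ a b → T (below ρ a b)) (sym (inverseʳ u)) (sym (inverseʳ v)) (arc⇒below′ u v uv)))
      ... | inj₁ lt = subst₂ (λ a b → toℕ (c a) ℕ.< toℕ (c b)) (inverseʳ u) (inverseʳ v) lt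
      ... | inj₂ (_ , ω-reversed) = ⊥-elim (ℕP.<-irrefl refl (ℕP.<-≤-trans (ω-mono u v (arc⇒below′ u v uv))
                                      (subst₂ (λ a b → toℕ (ω a) ℕ.≤ toℕ (ω b)) (inverseʳ v) (inverseʳ u) ω-reversed)))

    increasingAlong⇒sorted-isLinearExtension : T (increasingAlong ρ c) → IsLinearExtension sorted
    increasingAlong⇒sorted-isLinearExtension inc = sorted-injective , λ i j below →
      subst₂ ℕ._<_ (rank-sorted i) (rank-sorted j)
        (rank-mono (inj₁ (increasingAlong-below ρ c inc (sorted i) (sorted j) below)))

    sorted-compatible : Compatible (labelsAlong sorted) (c ∘ sorted)
    sorted-compatible i j i<j with sorted-increasing i j i<j
    ... | inj₁ lt = inj₁ lt
    ... | inj₂ (e , lt) = inj₂ (e , ℕP.<⇒≤ lt)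

    compatibleListing⇒≗sorted : ∀ y → IsLinearExtension y → Compatible (labelsAlong y) (c ∘ y) → ∀ i → y i ≡ sorted i
    compatibleListing⇒≗sorted y (y-injective , _) compat = increasing⇒≗sorted y f⁻¹ inverseˡ inverseʳ increasing
      where
      open FinEndo.Inverse y y-injective
      increasing : ∀ i j → toℕ i ℕ.< toℕ j → y i ◁ y j
      increasing i j i<j with compat i j i<j
      ... | inj₁ lt = inj₁ lt
      ... | inj₂ (e , ω≤) with ℕP.m≤n⇒m<n∨m≡n ω≤
      ...   | inj₁ ω< = inj₂ (e , ω<)
      ...   | inj₂ ω≡ = ⊥-elim (ℕP.<-irrefl (sym (cong toℕ (y-injective (ω-injective (FinP.toℕ-injective ω≡))))) i<j)

  module _ (n : ℕ) where

    listingTerm : (Fin d → Fin d) → (Fin d → Fin n) → Poly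
    listingTerm y c = if isLinearExtension ρ y ∧ compatible (labelsAlong y) (c ∘ y) then qpow (colourWeight c) else []

    listingTerm-nonzero : ∀ y c → ¬ listingTerm y c ≋ [] → IsLinearExtension y × Compatible (labelsAlong y) (c ∘ y)
    listingTerm-nonzero y c t≉[] with isLinearExtension ρ y ∧ compatible (labelsAlong y) (c ∘ y) in t
    ... | false = ⊥-elim (t≉[] ≋-refl)
    ... | true = isLinearExtension⁻ y (T-∧⁻ˡ (≡true⇒T t)) , compatible⇒Compatible (labelsAlong y) (c ∘ y) (T-∧⁻ʳ (≡true⇒T t))

    ∑-listings : ∀ c → ∑[ y ∈ colourings d d ] listingTerm y c ≋ (if increasingAlong ρ c then qpow (colourWeight c) else [])
    ∑-listings c with T? (increasingAlong ρ c)
    ... | no ¬inc rewrite ¬T⇒≡false ¬inc = ∑-zero (colourings d d) off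
      where
      off : ∀ y → listingTerm y c ≋ []
      off y with ≋[]⊎leading (listingTerm y c)
      ... | inj₁ t≋[] = t≋[]
      ... | inj₂ t-leading = ⊥-elim (¬inc (uncurry (compatibleListing⇒increasingAlong c y)
                                            (listingTerm-nonzero y c (leading⇒≉[] t-leading))))
    ... | yes inc rewrite T⇒≡true inc = ≋-trans (colourings-enumerate d d (λ y → listingTerm y c) sorted off on) at-sorted
      where
      open ColourOrder c using (sorted)
      off : ∀ y → ¬ Pointwise _≡_ y sorted → listingTerm y c ≋ []
      off y y≉sorted with ≋[]⊎leading (listingTerm y c)
      ... | inj₁ t≋[] = t≋[]
      ... | inj₂ t-leading = ⊥-elim (y≉sorted (uncurry (compatibleListing⇒≗sorted c y)
                                                (listingTerm-nonzero y c (leading⇒≉[] t-leading))))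
      on : ∀ y → Pointwise _≡_ y sorted → listingTerm y c ≋ listingTerm sorted c
      on y y≗sorted = ≋-reflexive (cong (λ b → if b then qpow (colourWeight c) else [])
        (cong₂ _∧_ (isLinearExtension-cong y≗sorted) (compatible-cong (cong (toℕ ∘ ω) ∘ y≗sorted) (cong c ∘ y≗sorted))))
      at-sorted : listingTerm sorted c ≋ qpow (colourWeight c)
      at-sorted rewrite T⇒≡true (isLinearExtension⁺ sorted (increasingAlong⇒sorted-isLinearExtension c inc))
                      | T⇒≡true (Compatible⇒compatible (labelsAlong sorted) (c ∘ sorted) (sorted-compatible c)) = ≋-refl

    ∑-colourings-of-listing : ∀ y →
      ∑[ c ∈ colourings d n ] listingTerm y c ≋ (if isLinearExtension ρ y then ∑-compatible (labelsAlong y) n else [])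
    ∑-colourings-of-listing y with T? (isLinearExtension ρ y)
    ... | no ¬le rewrite ¬T⇒≡false ¬le = ∑-zero (colourings d n) λ _ → ≋-refl
    ... | yes le rewrite T⇒≡true le = begin
      ∑[ c ∈ colourings d n ] (if compatible σ (c ∘ y) then qpow (colourWeight c) else [])
        ≈⟨ ∑-cong (colourings d n) (λ c → ≋-reflexive (cong (λ w → if compatible σ (c ∘ y) then qpow w else [])
                                                             (sym (colourWeight-∘ c y f⁻¹ inverseˡ inverseʳ)))) ⟩
      ∑[ c ∈ colourings d n ] h (c ∘ y)
        ≈⟨ ∑-∘-bijection y f⁻¹ inverseˡ inverseʳ h h-cong ⟩
      ∑-compatible σ n  ∎
      where
      open ≋-Reasoning
      open FinEndo.Inverse y (proj₁ (isLinearExtension⁻ y le))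
      σ = labelsAlong y
      h : (Fin d → Fin n) → Poly
      h f = if compatible σ f then qpow (colourWeight f) else []
      h-cong : ∀ {f g} → Pointwise _≡_ f g → h f ≋ h g
      h-cong f≗g = ≋-reflexive (cong₂ (λ b w → if b then qpow w else []) (compatible-cong (λ _ → refl) f≗g) (colourWeight-cong f≗g))

  ∑-increasing≋∑-linearExtensions : ∀ n →
    ∑-increasing ρ n ≋ ∑[ y ∈ colourings d d ] (if isLinearExtension ρ y then ∑-compatible (labelsAlong y) n else [])
  ∑-increasing≋∑-linearExtensions n = begin
    ∑-increasing ρ n
      ≈⟨ ∑-cong (colourings d n) (≋-sym ∘ ∑-listings n) ⟩
    ∑[ c ∈ colourings d n ] ∑[ y ∈ colourings d d ] listingTerm n y c
      ≈⟨ ∑-comm (colourings d n) (colourings d d) (λ c y → listingTerm n y c) ⟩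
    ∑[ y ∈ colourings d d ] ∑[ c ∈ colourings d n ] listingTerm n y c
      ≈⟨ ∑-cong (colourings d d) (∑-colourings-of-listing n) ⟩
    ∑[ y ∈ colourings d d ] (if isLinearExtension ρ y then ∑-compatible (labelsAlong y) n else [])  ∎
    where open ≋-Reasoning

module QBinomial where

  open QPoly
  open XPoly
  open BoolView using (T⇒≡true; ≡true⇒T)
  open Colourings
  open Words

  ∏< : (ℕ → Poly) → ℕ → Poly
  ∏< f zero = 1ₚ
  ∏< f (suc k) = ∏< f k *ₚ f k

  ∏<-suc : ∀ (f : ℕ → Poly) k → ∏< f (suc k) ≋ (f 0 *ₚ ∏< (f ∘ suc) k)
  ∏<-suc f zero = *ₚ-comm 1ₚ (f 0)
  ∏<-suc f (suc k) = ≋-trans (*ₚ-congʳ (f (suc k)) (∏<-suc f k)) (*ₚ-assoc (f 0) _ (f (suc k)))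

  ∏<-cong : ∀ {f g : ℕ → Poly} k → (∀ i → f i ≋ g i) → ∏< f k ≋ ∏< g k
  ∏<-cong zero f≋g = ≋-refl
  ∏<-cong (suc k) f≋g = *ₚ-cong (∏<-cong k f≋g) (f≋g k)

  ∏<-q* : ∀ (g : ℕ → Poly) k → ∏< (λ i → q *ₚ g i) k ≋ (qpow k *ₚ ∏< g k)
  ∏<-q* g zero = ≋-sym (*ₚ-identityˡ 1ₚ)
  ∏<-q* g (suc k) = ≋-trans (*ₚ-congʳ (q *ₚ g k) (∏<-q* g k))
    (≋-trans (regroup (qpow k) (∏< g k) q (g k)) (*ₚ-congʳ (∏< g k *ₚ g k) (≋-sym (qpow-suc k))))
    where
    regroup : ∀ a b c d → ((a *ₚ b) *ₚ (c *ₚ d)) ≋ ((c *ₚ a) *ₚ (b *ₚ d))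
    regroup = solve-∀ ℤ[q]-solverRing

  qint-comm : ∀ a j → ((qpow a *ₚ qint j) +ₚ qint a) ≋ ((qpow j *ₚ qint a) +ₚ qint j)
  qint-comm a j = begin
    qpow a *ₚ qint j +ₚ qint a  ≈⟨ +ₚ-comm _ (qint a) ⟩
    qint a +ₚ qpow a *ₚ qint j  ≈⟨ qint-+ a j ⟨
    qint (a ℕ.+ j)              ≡⟨ cong qint (ℕP.+-comm a j) ⟩
    qint (j ℕ.+ a)              ≈⟨ qint-+ j a ⟩
    qint j +ₚ qpow j *ₚ qint a  ≈⟨ +ₚ-comm (qint j) _ ⟩
    qpow j *ₚ qint a +ₚ qint j  ∎
    where open ≋-Reasoning

  qint-suc′ : ∀ a → qint (suc a) ≋ (qint a +ₚ qpow a)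
  qint-suc′ a = begin
    qint (suc a)            ≡⟨ cong qint (ℕP.+-comm 1 a) ⟩
    qint (a ℕ.+ 1)          ≈⟨ qint-+ a 1 ⟩
    qint a +ₚ qpow a *ₚ 1ₚ  ≈⟨ +ₚ-congˡ (qint a) (≋-trans (*ₚ-comm (qpow a) 1ₚ) (*ₚ-identityˡ (qpow a))) ⟩
    qint a +ₚ qpow a        ∎
    where open ≋-Reasoning

  -- φ n a i = [n + i]_q − [a]_q, written to be visibly linear in x = [n]_q.
  φ : ℕ → ℕ → ℕ → Poly
  φ n a i = (qpow i *ₚ qint n) +ₚ (qint i +ₚ negₚ (qint a))

  Φ : ℕ → ℕ → ℕ → Poly
  Φ n a = ∏< (φ n a)

  φ-suc : ∀ n a i → φ n (suc a) (suc i) ≋ (q *ₚ φ n a i)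
  φ-suc n a i = ≋-trans
    (+ₚ-cong (*ₚ-congʳ (qint n) (qpow-suc i)) (+ₚ-cong (qint-suc i) (negₚ-cong (qint-suc a))))
    (factor-q q (qpow i) (qint n) (qint i) (qint a))
    where
    factor-q : ∀ q p x u v → (((q *ₚ p) *ₚ x) +ₚ ((1ₚ +ₚ (q *ₚ u)) +ₚ negₚ (1ₚ +ₚ (q *ₚ v)))) ≋ (q *ₚ ((p *ₚ x) +ₚ (u +ₚ negₚ v)))
    factor-q = solve-∀ ℤ[q]-solverRing

  φ-split : ∀ n a d → φ n a d ≋ ((qpow a *ₚ qint (suc d)) +ₚ (qpow d *ₚ φ n (suc a) 0))
  φ-split n a d = ≋-sym (begin
    qpow a *ₚ qint (suc d) +ₚ qpow d *ₚ φ n (suc a) 0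
      ≈⟨ +ₚ-cong (*ₚ-congˡ (qpow a) (qint-suc′ d)) (*ₚ-congˡ (qpow d) (+ₚ-congˡ (1ₚ *ₚ qint n) (+ₚ-congˡ [] (negₚ-cong (qint-suc′ a))))) ⟩
    qpow a *ₚ (qint d +ₚ qpow d) +ₚ qpow d *ₚ (1ₚ *ₚ qint n +ₚ ([] +ₚ negₚ (qint a +ₚ qpow a)))
      ≈⟨ expand (qpow a) (qint d) (qpow d) (qint n) (qint a) ⟩
    qpow d *ₚ qint n +ₚ ((qpow a *ₚ qint d +ₚ qint a) +ₚ negₚ (qpow d *ₚ qint a +ₚ qint a))
      ≈⟨ +ₚ-congˡ (qpow d *ₚ qint n) (+ₚ-congʳ (negₚ (qpow d *ₚ qint a +ₚ qint a)) (qint-comm a d)) ⟩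
    qpow d *ₚ qint n +ₚ ((qpow d *ₚ qint a +ₚ qint d) +ₚ negₚ (qpow d *ₚ qint a +ₚ qint a))
      ≈⟨ cancel (qpow d) (qint a) (qint d) (qint n) ⟩
    φ n a d  ∎)
    where
    open ≋-Reasoning
    expand : ∀ A D P X I → ((A *ₚ (D +ₚ P)) +ₚ (P *ₚ ((1ₚ *ₚ X) +ₚ ([] +ₚ negₚ (I +ₚ A)))))
                         ≋ ((P *ₚ X) +ₚ (((A *ₚ D) +ₚ I) +ₚ negₚ ((P *ₚ I) +ₚ I)))
    expand = solve-∀ ℤ[q]-solverRing
    cancel : ∀ P I D X → ((P *ₚ X) +ₚ (((P *ₚ I) +ₚ D) +ₚ negₚ ((P *ₚ I) +ₚ I))) ≋ ((P *ₚ X) +ₚ (D +ₚ negₚ I))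
    cancel = solve-∀ ℤ[q]-solverRing

  Φ-pascal : ∀ n a d → Φ n a (suc d) ≋ (((qint (suc d) *ₚ qpow a) *ₚ Φ n a d) +ₚ Φ n (suc a) (suc d))
  Φ-pascal n a d = begin
    Φ n a d *ₚ φ n a d
      ≈⟨ *ₚ-congˡ (Φ n a d) (φ-split n a d) ⟩
    Φ n a d *ₚ (qpow a *ₚ qint (suc d) +ₚ qpow d *ₚ φ n (suc a) 0)
      ≈⟨ distribute (Φ n a d) (qpow a) (qint (suc d)) (qpow d) (φ n (suc a) 0) ⟩
    (qint (suc d) *ₚ qpow a) *ₚ Φ n a d +ₚ φ n (suc a) 0 *ₚ (qpow d *ₚ Φ n a d)
      ≈⟨ +ₚ-congˡ ((qint (suc d) *ₚ qpow a) *ₚ Φ n a d) (≋-sym Φ-suc-suc) ⟩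
    (qint (suc d) *ₚ qpow a) *ₚ Φ n a d +ₚ Φ n (suc a) (suc d)  ∎
    where
    open ≋-Reasoning
    Φ-suc-suc : Φ n (suc a) (suc d) ≋ (φ n (suc a) 0 *ₚ (qpow d *ₚ Φ n a d))
    Φ-suc-suc = ≋-trans (∏<-suc (φ n (suc a)) d)
      (*ₚ-congˡ (φ n (suc a) 0) (≋-trans (∏<-cong d (φ-suc n a)) (∏<-q* (φ n a) d)))
    distribute : ∀ P A D Q F → (P *ₚ ((A *ₚ D) +ₚ (Q *ₚ F))) ≋ (((D *ₚ A) *ₚ P) +ₚ (F *ₚ (Q *ₚ P)))
    distribute = solve-∀ ℤ[q]-solverRing

  φ-vanishes : ∀ n k → φ n (n ℕ.+ k) k ≋ []
  φ-vanishes n k = ≋-trans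
    (+ₚ-congˡ (qpow k *ₚ qint n) (+ₚ-congˡ (qint k) (negₚ-cong (≋-trans (≋-reflexive (cong qint (ℕP.+-comm n k))) (qint-+ k n)))))
    (cancel (qpow k) (qint n) (qint k))
    where
    cancel : ∀ Q X I → ((Q *ₚ X) +ₚ (I +ₚ negₚ (I +ₚ (Q *ₚ X)))) ≋ []
    cancel = solve-∀ ℤ[q]-solverRing

  Φ-vanishes : ∀ n a k → n ℕ.≤ a → a ℕ.< n ℕ.+ k → Φ n a k ≋ []
  Φ-vanishes n a zero n≤a a<n+0 = ⊥-elim (ℕP.<-irrefl refl (ℕP.≤-<-trans n≤a (subst (a ℕ.<_) (ℕP.+-identityʳ n) a<n+0)))
  Φ-vanishes n a (suc k) n≤a a<n+k+1 with ℕP.<-cmp a (n ℕ.+ k)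
  ... | tri< a<n+k _ _ = *ₚ-zeroˡ-≋ (φ n a k) (Φ-vanishes n a k n≤a a<n+k)
  ... | tri≈ _ refl _ = ≋-trans (*ₚ-congˡ (Φ n (n ℕ.+ k) k) (φ-vanishes n k)) (*ₚ-zeroʳ (Φ n (n ℕ.+ k) k))
  ... | tri> _ _ a>n+k = ⊥-elim (ℕP.<-irrefl refl (ℕP.<-≤-trans a>n+k (ℕP.≤-pred (subst (a ℕ.<_) (ℕP.+-suc n k) a<n+k+1))))

  ∑-compatibleFrom : ℕ → ℕ → List Bool → Poly
  ∑-compatibleFrom n L bs = ∑[ f ∈ colourings (length bs) n ] (if compatibleFrom L bs f then qpow (colourWeight f) else [])

  module _ (n : ℕ) (bs : List Bool) where

    firstColourTerm : ℕ → Poly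
    firstColourTerm m = qpow (suc m) *ₚ ∑-compatibleFrom n m bs

    ∑-firstColour≥ : ℕ → Poly
    ∑-firstColour≥ m = ∑[ v ∈ allFin n ] (if m ≤ᵇ toℕ v then firstColourTerm (toℕ v) else [])

  ∑-compatibleFrom-∷ : ∀ n b bs L → ∑-compatibleFrom n L (b ∷ bs) ≋ ∑-firstColour≥ n bs (L ℕ.+ bit b)
  ∑-compatibleFrom-∷ n b bs L = ≋-trans (∑-allFuns-suc (length bs) (allFin n) _) (∑-cong (allFin n) first-colour)
    where
    Fs = colourings (length bs) n
    first-colour : ∀ v →
      ∑[ g ∈ Fs ] (if (L ≤[ b ]ᵇ toℕ v) ∧ compatibleFrom (toℕ v) bs g then qpow (colourWeight (v ∷ᶠ g)) else [])
      ≋ (if (L ℕ.+ bit b) ≤ᵇ toℕ v then firstColourTerm n bs (toℕ v) else [])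
    first-colour v with (L ℕ.+ bit b) ≤ᵇ toℕ v
    ... | false = ∑-zero Fs λ _ → ≋-refl
    ... | true = ≋-trans (∑-cong Fs factor) (≋-sym (*ₚ-distribˡ-∑ Fs (qpow (suc (toℕ v))) _))
      where
      factor : ∀ g → (if compatibleFrom (toℕ v) bs g then qpow (colourWeight (v ∷ᶠ g)) else [])
                     ≋ (qpow (suc (toℕ v)) *ₚ (if compatibleFrom (toℕ v) bs g then qpow (colourWeight g) else []))
      factor g with compatibleFrom (toℕ v) bs g
      ... | true = ≋-trans (≋-reflexive (cong qpow (colourWeight-∷ v g))) (qpow-+ (suc (toℕ v)) (colourWeight g))
      ... | false = ≋-sym (*ₚ-zeroʳ (qpow (suc (toℕ v))))

  private
    ≤ᵇ-suc : ∀ m v → (suc m ≤ᵇ suc v) ≡ (m ≤ᵇ v)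
    ≤ᵇ-suc zero v = refl
    ≤ᵇ-suc (suc m) v = refl

    ≤ᵇ-split : ∀ m v (x : Poly) → (if m ≤ᵇ v then x else []) ≋ ((if v ℕ.≡ᵇ m then x else []) +ₚ (if suc m ≤ᵇ v then x else []))
    ≤ᵇ-split zero zero x = ≋-sym (+ₚ-identityʳ x)
    ≤ᵇ-split zero (suc v) x = ≋-refl
    ≤ᵇ-split (suc m) zero x = ≋-refl
    ≤ᵇ-split (suc m) (suc v) x rewrite ≤ᵇ-suc m v | ≤ᵇ-suc (suc m) v = ≤ᵇ-split m v x

  ∑-firstColour≥-step : ∀ n bs m → m ℕ.< n → ∑-firstColour≥ n bs m ≋ (firstColourTerm n bs m +ₚ ∑-firstColour≥ n bs (suc m))
  ∑-firstColour≥-step n bs m m<n =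
    ≋-trans (∑-cong (allFin n) (λ v → ≤ᵇ-split m (toℕ v) (firstColourTerm n bs (toℕ v))))
      (≋-trans (∑-distrib-∙ (allFin n) _ _) (+ₚ-congʳ (∑-firstColour≥ n bs (suc m)) first-is-m))
    where
    h : Fin n → Poly
    h v = if toℕ v ℕ.≡ᵇ m then firstColourTerm n bs (toℕ v) else []
    off : ∀ v → ¬ v ≡ Fin.fromℕ< m<n → h v ≋ []
    off v v≢m with toℕ v ℕ.≡ᵇ m in eq
    ... | false = ≋-refl
    ... | true = ⊥-elim (v≢m (FinP.toℕ-injective (trans (ℕP.≡ᵇ⇒≡ (toℕ v) m (≡true⇒T eq)) (sym (FinP.toℕ-fromℕ< m<n)))))
    first-is-m : ∑ (allFin n) h ≋ firstColourTerm n bs m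
    first-is-m = ≋-trans (allFin-enumerates n h (Fin.fromℕ< m<n) off λ { _ refl → ≋-refl }) at-m
      where
      at-m : h (Fin.fromℕ< m<n) ≋ firstColourTerm n bs m
      at-m rewrite FinP.toℕ-fromℕ< m<n | T⇒≡true (ℕP.≡⇒≡ᵇ m m refl) = ≋-refl

  ∑-firstColour≥-empty : ∀ n bs m → n ℕ.≤ m → ∑-firstColour≥ n bs m ≋ []
  ∑-firstColour≥-empty n bs m n≤m = ∑-zero (allFin n) off
    where
    off : ∀ v → (if m ≤ᵇ toℕ v then firstColourTerm n bs (toℕ v) else []) ≋ []
    off v with m ≤ᵇ toℕ v in eq
    ... | false = ≋-refl
    ... | true = ⊥-elim (ℕP.<-irrefl refl (ℕP.<-≤-trans (FinP.toℕ<n v) (ℕP.≤-trans n≤m (ℕP.≤ᵇ⇒≤ m (toℕ v) (≡true⇒T eq)))))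

  -- With a = L + strictCount bs, subtracting from each colour L plus the strict steps so far
  -- leaves weakly increasing maps into [n − a], counted by ∏_{i<d} [n − a + i]_q / [d]_q!,
  -- and q^a [n − a + i]_q = [n + i]_q − [a]_q.  Stated without division or subtraction.
  ClosedForm : ℕ → ℕ → List Bool → Set
  ClosedForm n L bs =
    ((qfact d *ₚ qpow ((L ℕ.+ strictCount bs) ℕ.* d)) *ₚ ∑-compatibleFrom n L bs)
    ≋ (qpow (d ℕ.+ d ℕ.* L ℕ.+ strictWeight bs) *ₚ Φ n (L ℕ.+ strictCount bs) d)
    where d = length bs

  FirstColourClosedForm : ℕ → List Bool → ℕ → Set
  FirstColourClosedForm n bs m =
    ((qfact (suc d) *ₚ qpow ((m ℕ.+ strictCount bs) ℕ.* suc d)) *ₚ ∑-firstColour≥ n bs m)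
    ≋ (qpow (suc d ℕ.+ suc d ℕ.* m ℕ.+ strictWeight bs) *ₚ Φ n (m ℕ.+ strictCount bs) (suc d))
    where d = length bs

  module _ (n : ℕ) (bs : List Bool) (m : ℕ) where

    private
      d = length bs
      a = m ℕ.+ strictCount bs
      E = strictWeight bs
      E′ = suc d ℕ.+ suc d ℕ.* m ℕ.+ E
      LF = qfact (suc d) *ₚ qpow (a ℕ.* suc d)

    closedForm-head : ClosedForm n m bs → (LF *ₚ firstColourTerm n bs m) ≋ (qpow E′ *ₚ ((qint (suc d) *ₚ qpow a) *ₚ Φ n a d))
    closedForm-head IH = begin
      (qfact d *ₚ qint (suc d) *ₚ qpow (a ℕ.* suc d)) *ₚ (qpow (suc m) *ₚ S)
        ≈⟨ *ₚ-congʳ (qpow (suc m) *ₚ S) (*ₚ-congˡ (qfact d *ₚ qint (suc d))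
             (≋-trans (≋-reflexive (cong qpow (ℕP.*-suc a d))) (qpow-+ a (a ℕ.* d)))) ⟩
      (qfact d *ₚ qint (suc d) *ₚ (qpow a *ₚ qpow (a ℕ.* d))) *ₚ (qpow (suc m) *ₚ S)
        ≈⟨ regroup₁ (qfact d) (qint (suc d)) (qpow a) (qpow (a ℕ.* d)) (qpow (suc m)) S ⟩
      ((qint (suc d) *ₚ qpow a) *ₚ qpow (suc m)) *ₚ ((qfact d *ₚ qpow (a ℕ.* d)) *ₚ S)
        ≈⟨ *ₚ-congˡ ((qint (suc d) *ₚ qpow a) *ₚ qpow (suc m)) IH ⟩
      ((qint (suc d) *ₚ qpow a) *ₚ qpow (suc m)) *ₚ (qpow (d ℕ.+ d ℕ.* m ℕ.+ E) *ₚ Φ n a d)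
        ≈⟨ regroup₂ (qint (suc d)) (qpow a) (qpow (suc m)) (qpow (d ℕ.+ d ℕ.* m ℕ.+ E)) (Φ n a d) ⟩
      (qpow (suc m) *ₚ qpow (d ℕ.+ d ℕ.* m ℕ.+ E)) *ₚ ((qint (suc d) *ₚ qpow a) *ₚ Φ n a d)
        ≈⟨ *ₚ-congʳ ((qint (suc d) *ₚ qpow a) *ₚ Φ n a d)
             (≋-trans (≋-sym (qpow-+ (suc m) (d ℕ.+ d ℕ.* m ℕ.+ E))) (≋-reflexive (cong qpow (exponent d m E)))) ⟩
      qpow E′ *ₚ ((qint (suc d) *ₚ qpow a) *ₚ Φ n a d)  ∎
      where
      open ≋-Reasoning
      S = ∑-compatibleFrom n m bs
      regroup₁ : ∀ F I A A′ M S → (((F *ₚ I) *ₚ (A *ₚ A′)) *ₚ (M *ₚ S)) ≋ (((I *ₚ A) *ₚ M) *ₚ ((F *ₚ A′) *ₚ S))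
      regroup₁ = solve-∀ ℤ[q]-solverRing
      regroup₂ : ∀ I A M Q P → (((I *ₚ A) *ₚ M) *ₚ (Q *ₚ P)) ≋ ((M *ₚ Q) *ₚ ((I *ₚ A) *ₚ P))
      regroup₂ = solve-∀ ℤ[q]-solverRing
      exponent : ∀ d m E → suc m ℕ.+ (d ℕ.+ d ℕ.* m ℕ.+ E) ≡ suc d ℕ.+ suc d ℕ.* m ℕ.+ E
      exponent = solveℕ

    closedForm-tail : FirstColourClosedForm n bs (suc m) → (LF *ₚ ∑-firstColour≥ n bs (suc m)) ≋ (qpow E′ *ₚ Φ n (suc a) (suc d))
    closedForm-tail IH = *ₚ-cancelˡ (qpow (suc d)) (qpow-≉[] (suc d)) (begin
      qpow (suc d) *ₚ ((qfact (suc d) *ₚ qpow (a ℕ.* suc d)) *ₚ Y)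
        ≈⟨ regroup (qpow (suc d)) (qfact (suc d)) (qpow (a ℕ.* suc d)) Y ⟩
      (qfact (suc d) *ₚ (qpow (suc d) *ₚ qpow (a ℕ.* suc d))) *ₚ Y
        ≈⟨ *ₚ-congʳ Y (*ₚ-congˡ (qfact (suc d)) (≋-sym (qpow-+ (suc d) (a ℕ.* suc d)))) ⟩
      (qfact (suc d) *ₚ qpow (suc a ℕ.* suc d)) *ₚ Y
        ≈⟨ IH ⟩
      qpow (suc d ℕ.+ suc d ℕ.* suc m ℕ.+ E) *ₚ Φ n (suc a) (suc d)
        ≈⟨ *ₚ-congʳ (Φ n (suc a) (suc d)) (≋-trans (≋-reflexive (cong qpow (exponent d m E))) (qpow-+ (suc d) E′)) ⟩
      (qpow (suc d) *ₚ qpow E′) *ₚ Φ n (suc a) (suc d)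
        ≈⟨ *ₚ-assoc (qpow (suc d)) (qpow E′) _ ⟩
      qpow (suc d) *ₚ (qpow E′ *ₚ Φ n (suc a) (suc d))  ∎)
      where
      open ≋-Reasoning
      Y = ∑-firstColour≥ n bs (suc m)
      regroup : ∀ Q F A Y → (Q *ₚ ((F *ₚ A) *ₚ Y)) ≋ ((F *ₚ (Q *ₚ A)) *ₚ Y)
      regroup = solve-∀ ℤ[q]-solverRing
      exponent : ∀ d m E → suc d ℕ.+ suc d ℕ.* suc m ℕ.+ E ≡ suc d ℕ.+ (suc d ℕ.+ suc d ℕ.* m ℕ.+ E)
      exponent = solveℕ

  -- Downward induction on the least admissible first colour m, driven by Φ-pascal.
  firstColourClosedForm : ∀ n bs → (∀ L → L ℕ.+ strictCount bs ℕ.< n ℕ.+ length bs → ClosedForm n L bs) →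
    ∀ fuel m → n ℕ.≤ fuel ℕ.+ m → m ℕ.+ strictCount bs ℕ.< n ℕ.+ suc (length bs) → FirstColourClosedForm n bs m
  firstColourClosedForm n bs IH fuel m n≤fuel+m a<n+d+1 with m ℕ.<? n
  ... | no m≮n = ≋-trans (*ₚ-congˡ LF (∑-firstColour≥-empty n bs m n≤m)) (≋-trans (*ₚ-zeroʳ LF)
                   (≋-sym (≋-trans (*ₚ-congˡ (qpow E′) (Φ-vanishes n _ _ (ℕP.≤-trans n≤m (ℕP.m≤m+n m _)) a<n+d+1)) (*ₚ-zeroʳ (qpow E′)))))
    where
    n≤m = ℕP.≮⇒≥ m≮n
    LF = qfact (suc (length bs)) *ₚ qpow ((m ℕ.+ strictCount bs) ℕ.* suc (length bs))
    E′ = suc (length bs) ℕ.+ suc (length bs) ℕ.* m ℕ.+ strictWeight bs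
  firstColourClosedForm n bs IH zero m n≤m _ | yes m<n = ⊥-elim (ℕP.<-irrefl refl (ℕP.<-≤-trans m<n n≤m))
  firstColourClosedForm n bs IH (suc fuel) m n≤fuel+m a<n+d+1 | yes m<n = begin
    LF *ₚ ∑-firstColour≥ n bs m
      ≈⟨ *ₚ-congˡ LF (∑-firstColour≥-step n bs m m<n) ⟩
    LF *ₚ (firstColourTerm n bs m +ₚ ∑-firstColour≥ n bs (suc m))
      ≈⟨ *ₚ-distribˡ LF (firstColourTerm n bs m) (∑-firstColour≥ n bs (suc m)) ⟩
    LF *ₚ firstColourTerm n bs m +ₚ LF *ₚ ∑-firstColour≥ n bs (suc m)
      ≈⟨ +ₚ-cong (closedForm-head n bs m (IH m a<n+d)) (closedForm-tail n bs m tail-IH) ⟩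
    qpow E′ *ₚ ((qint (suc d) *ₚ qpow a) *ₚ Φ n a d) +ₚ qpow E′ *ₚ Φ n (suc a) (suc d)
      ≈⟨ *ₚ-distribˡ (qpow E′) ((qint (suc d) *ₚ qpow a) *ₚ Φ n a d) (Φ n (suc a) (suc d)) ⟨
    qpow E′ *ₚ ((qint (suc d) *ₚ qpow a) *ₚ Φ n a d +ₚ Φ n (suc a) (suc d))
      ≈⟨ *ₚ-congˡ (qpow E′) (Φ-pascal n a d) ⟨
    qpow E′ *ₚ Φ n a (suc d)  ∎
    where
    open ≋-Reasoning
    d = length bs
    a = m ℕ.+ strictCount bs
    E′ = suc d ℕ.+ suc d ℕ.* m ℕ.+ strictWeight bs
    LF = qfact (suc d) *ₚ qpow (a ℕ.* suc d)
    a<n+d : a ℕ.< n ℕ.+ d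
    a<n+d = ℕP.+-mono-<-≤ m<n (strictCount≤length bs)
    tail-IH : FirstColourClosedForm n bs (suc m)
    tail-IH = firstColourClosedForm n bs IH fuel (suc m) (subst (n ℕ.≤_) (sym (ℕP.+-suc fuel m)) n≤fuel+m)
                (subst (suc a ℕ.<_) (sym (ℕP.+-suc n d)) (ℕ.s≤s a<n+d))

  closedForm : ∀ n bs L → L ℕ.+ strictCount bs ℕ.< n ℕ.+ length bs → ClosedForm n L bs
  closedForm n [] L _ = *ₚ-congʳ (∑-compatibleFrom n L []) (*ₚ-congˡ 1ₚ (≋-reflexive (cong qpow (ℕP.*-zeroʳ (L ℕ.+ 0)))))
  closedForm n (b ∷ bs) L a<n+d = begin
    (qfact d *ₚ qpow ((L ℕ.+ strictCount (b ∷ bs)) ℕ.* d)) *ₚ ∑-compatibleFrom n L (b ∷ bs)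
      ≈⟨ *ₚ-cong (*ₚ-congˡ (qfact d) (≋-reflexive (cong (λ a → qpow (a ℕ.* d)) reassoc))) (∑-compatibleFrom-∷ n b bs L) ⟩
    (qfact d *ₚ qpow ((m ℕ.+ strictCount bs) ℕ.* d)) *ₚ ∑-firstColour≥ n bs m
      ≈⟨ firstColourClosedForm n bs (closedForm n bs) n m (ℕP.m≤m+n n m) (subst (ℕ._< n ℕ.+ d) reassoc a<n+d) ⟩
    qpow (d ℕ.+ d ℕ.* m ℕ.+ strictWeight bs) *ₚ Φ n (m ℕ.+ strictCount bs) d
      ≡⟨ cong₂ (λ e a → qpow e *ₚ Φ n a d) (exponent (length bs) L (bit b) (strictWeight bs)) (sym reassoc) ⟩
    qpow (d ℕ.+ d ℕ.* L ℕ.+ strictWeight (b ∷ bs)) *ₚ Φ n (L ℕ.+ strictCount (b ∷ bs)) d  ∎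
    where
    open ≋-Reasoning
    d = suc (length bs)
    m = L ℕ.+ bit b
    reassoc : L ℕ.+ strictCount (b ∷ bs) ≡ m ℕ.+ strictCount bs
    reassoc = sym (ℕP.+-assoc L (bit b) (strictCount bs))
    exponent : ∀ l L β e → suc l ℕ.+ suc l ℕ.* (L ℕ.+ β) ℕ.+ e ≡ suc l ℕ.+ suc l ℕ.* L ℕ.+ (β ℕ.* suc l ℕ.+ e)
    exponent = solveℕ

  closedForm₀ : ∀ n bs → strictCount bs ℕ.< n ℕ.+ length bs →
    ((qfact (length bs) *ₚ qpow (strictCount bs ℕ.* length bs)) *ₚ ∑-compatibleFrom n 0 bs)
    ≋ (qpow (length bs ℕ.+ strictWeight bs) *ₚ Φ n (strictCount bs) (length bs))
  closedForm₀ n bs c<n+d = ≋-trans (closedForm n bs 0 c<n+d)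
    (*ₚ-congʳ (Φ n (strictCount bs) (length bs)) (≋-reflexive (cong (λ e → qpow (e ℕ.+ strictWeight bs)) d+d*0≡d)))
    where
    d+d*0≡d : length bs ℕ.+ length bs ℕ.* 0 ≡ length bs
    d+d*0≡d = trans (cong (length bs ℕ.+_) (ℕP.*-zeroʳ (length bs))) (ℕP.+-identityʳ (length bs))

  closedForm-compatible : ∀ n {d} (σ : Fin d → ℕ) → strictCount (strictWord σ) ℕ.< n ℕ.+ d →
    ((qfact d *ₚ qpow (strictCount (strictWord σ) ℕ.* d)) *ₚ ∑-compatible σ n)
    ≋ (qpow (d ℕ.+ strictWeight (strictWord σ)) *ₚ Φ n (strictCount (strictWord σ)) d)
  closedForm-compatible n σ = generalise (strictWord σ) (length-strictWord σ)
    where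
    generalise : ∀ {d} bs → length bs ≡ d → strictCount bs ℕ.< n ℕ.+ d →
      ((qfact d *ₚ qpow (strictCount bs ℕ.* d)) *ₚ ∑[ f ∈ colourings d n ] (if compatibleFrom 0 bs f then qpow (colourWeight f) else []))
      ≋ (qpow (d ℕ.+ strictWeight bs) *ₚ Φ n (strictCount bs) d)
    generalise bs refl = closedForm₀ n bs

  Φₓ : ℕ → ℕ → List Poly
  Φₓ a zero = 1ₚ ∷ []
  Φₓ a (suc k) = linear*ₓ (qpow k) (qint k +ₚ negₚ (qint a)) (Φₓ a k)

  evalX-Φₓ : ∀ n a k → evalX (Φₓ a k) (qint n) ≋ Φ n a k
  evalX-Φₓ n a zero = ≋-trans (+ₚ-congˡ 1ₚ (*ₚ-zeroʳ (qint n))) (+ₚ-identityʳ 1ₚ)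
  evalX-Φₓ n a (suc k) = ≋-trans (evalX-linear*ₓ (qpow k) (qint k +ₚ negₚ (qint a)) (Φₓ a k) (qint n))
    (≋-trans (*ₚ-congˡ (φ n a k) (evalX-Φₓ n a k)) (*ₚ-comm (φ n a k) (Φ n a k)))

  TopCoeffₓ-Φₓ : ∀ a k → TopCoeffₓ (Φₓ a k) k (qpow (triangular k))
  TopCoeffₓ-Φₓ a zero = TopCoeffₓ-const 1ₚ
  TopCoeffₓ-Φₓ a (suc k) = TopCoeffₓ-cong (≋-sym (qpow-+ k (triangular k)))
    (TopCoeffₓ-linear*ₓ (qpow k) (qint k +ₚ negₚ (qint a)) (TopCoeffₓ-Φₓ a k))


module ChiTilde {d} (adj : Rel d) (symmetric : ∀ u v → adj u v ≡ adj v u) (loopless : ∀ u → adj u u ≡ false)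
                (ω : Rel d → Fin d → Fin d) (natural : ∀ ρ → T (isAcyclicOrientation adj ρ) → IsNaturalLabeling ρ (ω ρ)) where

  open QPoly
  open XPoly
  open BoolView using (T-∧⁻ˡ)
  open Colourings
  open Orientations
  open Words
  open QBinomial

  -- The closed form for a listing carries q^(a·d), a ≤ d its number of ascents; q^(d·d) clears all of them.
  D : Poly
  D = qpow (d ℕ.* d) *ₚ qfact d

  D≉[] : ¬ D ≋ []
  D≉[] = *ₚ-≉[] (qpow-≉[] (d ℕ.* d)) (qfact-≉[] d)

  module _ (σ : Fin d → ℕ) where

    private
      c = strictCount (strictWord σ)
      E = strictWeight (strictWord σ)
      c≤d : c ℕ.≤ d
      c≤d = subst (c ℕ.≤_) (length-strictWord σ) (strictCount≤length (strictWord σ))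

    shift : ℕ
    shift = (d ℕ.∸ c) ℕ.* d ℕ.+ (d ℕ.+ E)

    listingₓ : List Poly
    listingₓ = scaleₓ (qpow shift) (Φₓ c d)

    evalX-listingₓ : ∀ n → 1 ℕ.≤ n → evalX listingₓ (qint n) ≋ (D *ₚ ∑-compatible σ n)
    evalX-listingₓ n 1≤n = ≋-sym (begin
      (qpow (d ℕ.* d) *ₚ qfact d) *ₚ ∑-compatible σ n
        ≈⟨ *ₚ-congʳ (∑-compatible σ n) (*ₚ-congʳ (qfact d) (≋-trans (≋-reflexive (cong qpow d*d≡)) (qpow-+ ((d ℕ.∸ c) ℕ.* d) (c ℕ.* d)))) ⟩
      ((qpow ((d ℕ.∸ c) ℕ.* d) *ₚ qpow (c ℕ.* d)) *ₚ qfact d) *ₚ ∑-compatible σ n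
        ≈⟨ regroup (qpow ((d ℕ.∸ c) ℕ.* d)) (qpow (c ℕ.* d)) (qfact d) (∑-compatible σ n) ⟩
      qpow ((d ℕ.∸ c) ℕ.* d) *ₚ ((qfact d *ₚ qpow (c ℕ.* d)) *ₚ ∑-compatible σ n)
        ≈⟨ *ₚ-congˡ (qpow ((d ℕ.∸ c) ℕ.* d)) (closedForm-compatible n σ c<n+d) ⟩
      qpow ((d ℕ.∸ c) ℕ.* d) *ₚ (qpow (d ℕ.+ E) *ₚ Φ n c d)
        ≈⟨ *ₚ-assoc (qpow ((d ℕ.∸ c) ℕ.* d)) (qpow (d ℕ.+ E)) (Φ n c d) ⟨
      (qpow ((d ℕ.∸ c) ℕ.* d) *ₚ qpow (d ℕ.+ E)) *ₚ Φ n c d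
        ≈⟨ *ₚ-cong (≋-sym (qpow-+ ((d ℕ.∸ c) ℕ.* d) (d ℕ.+ E))) (≋-sym (evalX-Φₓ n c d)) ⟩
      qpow shift *ₚ evalX (Φₓ c d) (qint n)
        ≈⟨ evalX-scaleₓ (qpow shift) (Φₓ c d) (qint n) ⟨
      evalX listingₓ (qint n)  ∎)
      where
      open ≋-Reasoning
      d*d≡ : d ℕ.* d ≡ (d ℕ.∸ c) ℕ.* d ℕ.+ c ℕ.* d
      d*d≡ = trans (cong (ℕ._* d) (sym (ℕP.m∸n+n≡m c≤d))) (ℕP.*-distribʳ-+ d (d ℕ.∸ c) c)
      c<n+d : c ℕ.< n ℕ.+ d
      c<n+d = ℕP.≤-<-trans c≤d (subst (d ℕ.<_) (ℕP.+-comm d n) (ℕP.m<m+n d 1≤n))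
      regroup : ∀ X Y F S → (((X *ₚ Y) *ₚ F) *ₚ S) ≋ (X *ₚ ((F *ₚ Y) *ₚ S))
      regroup = solve-∀ ℤ[q]-solverRing

    TopCoeffₓ-listingₓ : Injective _≡_ _≡_ σ → TopCoeffₓ listingₓ d (qpow (d ℕ.* d) *ₚ qpow (d ℕ.+ majFrom 1 (map σ (allFin d))))
    TopCoeffₓ-listingₓ σ-injective = TopCoeffₓ-cong top≋ (TopCoeffₓ-scaleₓ (qpow shift) (TopCoeffₓ-Φₓ c d))
      where
      exponent : shift ℕ.+ triangular d ≡ d ℕ.* d ℕ.+ (d ℕ.+ majFrom 1 (map σ (allFin d)))
      exponent = begin
        (d ℕ.∸ c) ℕ.* d ℕ.+ (d ℕ.+ E) ℕ.+ triangular d  ≡⟨ regroup₁ ((d ℕ.∸ c) ℕ.* d) d E (triangular d) ⟩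
        (d ℕ.∸ c) ℕ.* d ℕ.+ d ℕ.+ (E ℕ.+ triangular d)  ≡⟨ cong ((d ℕ.∸ c) ℕ.* d ℕ.+ d ℕ.+_) (strictWeight+triangular d σ σ-injective) ⟩
        (d ℕ.∸ c) ℕ.* d ℕ.+ d ℕ.+ (c ℕ.* d ℕ.+ M)       ≡⟨ regroup₂ (d ℕ.∸ c) c d M ⟩
        ((d ℕ.∸ c) ℕ.+ c) ℕ.* d ℕ.+ (d ℕ.+ M)           ≡⟨ cong (λ x → x ℕ.* d ℕ.+ (d ℕ.+ M)) (ℕP.m∸n+n≡m c≤d) ⟩
        d ℕ.* d ℕ.+ (d ℕ.+ M)                           ∎
        where
        open ≡-Reasoning
        M = majFrom 1 (map σ (allFin d))
        regroup₁ : ∀ X d E t → X ℕ.+ (d ℕ.+ E) ℕ.+ t ≡ X ℕ.+ d ℕ.+ (E ℕ.+ t)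
        regroup₁ = solveℕ
        regroup₂ : ∀ X c d M → X ℕ.* d ℕ.+ d ℕ.+ (c ℕ.* d ℕ.+ M) ≡ (X ℕ.+ c) ℕ.* d ℕ.+ (d ℕ.+ M)
        regroup₂ = solveℕ
      top≋ : (qpow shift *ₚ qpow (triangular d)) ≋ (qpow (d ℕ.* d) *ₚ qpow (d ℕ.+ majFrom 1 (map σ (allFin d))))
      top≋ = ≋-trans (≋-sym (qpow-+ shift (triangular d))) (≋-trans (≋-reflexive (cong qpow exponent)) (qpow-+ (d ℕ.* d) _))

  labels : Rel d → (Fin d → Fin d) → Fin d → ℕ
  labels ρ y = toℕ ∘ ω ρ ∘ y

  Pₓ : List Poly
  Pₓ = ∑ₓ (relations d) λ ρ → if isAcyclicOrientation adj ρ
         then ∑ₓ (colourings d d) (λ y → if isLinearExtension ρ y then listingₓ (labels ρ y) else []) else []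

  guarded-cong : ∀ b {A B : Poly} → (T b → A ≋ B) → (if b then A else []) ≋ (if b then B else [])
  guarded-cong true A≋B = A≋B _
  guarded-cong false _ = ≋-refl

  evalX-Pₓ : ∀ n → 1 ℕ.≤ n → evalX Pₓ (qint n) ≋ (D *ₚ chi adj n)
  evalX-Pₓ n 1≤n = begin
    evalX Pₓ (qint n)
      ≈⟨ ≋-trans (evalX-∑ₓ-if (relations d) AO _ (qint n)) (∑-cong (relations d) λ ρ → guarded-cong (AO ρ) λ _ →
           ≋-trans (evalX-∑ₓ-if (colourings d d) (LE ρ) _ (qint n)) (∑-cong (colourings d d) λ y → guarded-cong (LE ρ y) λ _ →
             evalX-listingₓ (labels ρ y) n 1≤n)) ⟩
    ∑[ ρ ∈ relations d ] (if AO ρ then ∑[ y ∈ colourings d d ] (if LE ρ y then D *ₚ ∑-compatible (labels ρ y) n else []) else [])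
      ≈⟨ ≋-sym (≋-trans (*ₚ-distribˡ-∑-if (relations d) AO D _) (∑-cong (relations d) λ ρ → guarded-cong (AO ρ) λ _ →
           *ₚ-distribˡ-∑-if (colourings d d) (LE ρ) D _)) ⟩
    D *ₚ ∑[ ρ ∈ relations d ] (if AO ρ then ∑[ y ∈ colourings d d ] (if LE ρ y then ∑-compatible (labels ρ y) n else []) else [])
      ≈⟨ *ₚ-congˡ D (∑-cong (relations d) λ ρ → guarded-cong (AO ρ) λ acyclic →
           ≋-sym (PPartitions.∑-increasing≋∑-linearExtensions adj loopless ρ (T-∧⁻ˡ acyclic) (ω ρ) (natural ρ acyclic) n)) ⟩
    D *ₚ ∑[ ρ ∈ relations d ] (if AO ρ then ∑-increasing ρ n else [])
      ≈⟨ *ₚ-congˡ D (chi≋∑-acyclicOrientations adj symmetric n) ⟨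
    D *ₚ chi adj n  ∎
    where
    open ≋-Reasoning
    AO = isAcyclicOrientation adj
    LE = isLinearExtension

  TopCoeffₓ-Pₓ : TopCoeffₓ Pₓ d (qpow (d ℕ.* d) *ₚ numerator adj ω)
  TopCoeffₓ-Pₓ = TopCoeffₓ-cong (≋-sym pull-out)
    (TopCoeffₓ-∑ₓ-if (relations d) AO λ ρ acyclic → TopCoeffₓ-∑ₓ-if (colourings d d) (LE ρ) λ y le →
      TopCoeffₓ-listingₓ (labels ρ y) (linearExtension-injective ρ acyclic y le ∘ proj₁ (natural ρ acyclic) ∘ FinP.toℕ-injective))
    where
    AO = isAcyclicOrientation adj
    LE = isLinearExtension
    linearExtension-injective : ∀ ρ (acyclic : T (AO ρ)) y → T (LE ρ y) → Injective _≡_ _≡_ y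
    linearExtension-injective ρ acyclic y le =
      proj₁ (PPartitions.isLinearExtension⁻ adj loopless ρ (T-∧⁻ˡ acyclic) (ω ρ) (natural ρ acyclic) y le)
    pull-out : (qpow (d ℕ.* d) *ₚ numerator adj ω)
      ≋ ∑[ ρ ∈ relations d ] (if AO ρ then ∑[ y ∈ colourings d d ]
          (if LE ρ y then qpow (d ℕ.* d) *ₚ qpow (d ℕ.+ maj (ω ρ ∘ y)) else []) else [])
    pull-out = ≋-trans (*ₚ-distribˡ-∑-if (relations d) AO (qpow (d ℕ.* d)) _) (∑-cong (relations d) λ ρ → guarded-cong (AO ρ) λ _ →
      *ₚ-distribˡ-∑-if (colourings d d) (LE ρ) (qpow (d ℕ.* d)) _)

  chiTilde-exists : Σ (List Poly) λ P → Σ Poly λ D → IsChiTilde adj P D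
  chiTilde-exists = Pₓ , D , (D≉[] ∘ mk≋) , λ n 1≤n → coeff≡ (evalX-Pₓ n 1≤n)

  chiTilde-leadingCoeff : ∀ P D′ → IsChiTilde adj P D′ → LeadingCoeffIs P D′ (numerator adj ω) (qfact d)
  chiTilde-leadingCoeff P D′ (_ , P-interpolates) = d , coeff≡ top-d , λ j d<j → coeff≡ (vanishes-above j d<j)
    where
    proportional : ∀ k → (D′ *ₚ coeffX Pₓ k) ≋ (D *ₚ coeffX P k)
    proportional = interpolants-proportional (chi adj) Pₓ D P D′ evalX-Pₓ (λ n 1≤n → mk≋ (P-interpolates n 1≤n))
    vanishes-above : ∀ j → d ℕ.< j → coeffX P j ≋ []
    vanishes-above j d<j = *ₚ-cancelˡ D D≉[] (begin
      D *ₚ coeffX P j    ≈⟨ proportional j ⟨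
      D′ *ₚ coeffX Pₓ j  ≈⟨ *ₚ-congˡ D′ (aboveₓ TopCoeffₓ-Pₓ j d<j) ⟩
      D′ *ₚ []           ≈⟨ *ₚ-zeroʳ D′ ⟩
      []                 ≈⟨ *ₚ-zeroʳ D ⟨
      D *ₚ []            ∎)
      where open ≋-Reasoning
    top-d : (coeffX P d *ₚ qfact d) ≋ (D′ *ₚ numerator adj ω)
    top-d = *ₚ-cancelˡ D D≉[] (begin
      D *ₚ (coeffX P d *ₚ qfact d)                            ≈⟨ *ₚ-assoc D (coeffX P d) (qfact d) ⟨
      (D *ₚ coeffX P d) *ₚ qfact d                            ≈⟨ *ₚ-congʳ (qfact d) (proportional d) ⟨
      (D′ *ₚ coeffX Pₓ d) *ₚ qfact d                          ≈⟨ *ₚ-congʳ (qfact d) (*ₚ-congˡ D′ (topₓ TopCoeffₓ-Pₓ)) ⟩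
      (D′ *ₚ (qpow (d ℕ.* d) *ₚ numerator adj ω)) *ₚ qfact d  ≈⟨ regroup (qpow (d ℕ.* d)) (qfact d) D′ (numerator adj ω) ⟩
      D *ₚ (D′ *ₚ numerator adj ω)                            ∎)
      where
      open ≋-Reasoning
      regroup : ∀ X F D′ N → ((D′ *ₚ (X *ₚ N)) *ₚ F) ≋ ((X *ₚ F) *ₚ (D′ *ₚ N))
      regroup = solve-∀ ℤ[q]-solverRing

corollary11 : (d : ℕ) (adj : Fin d → Fin d → Bool)
    → (∀ u v → adj u v ≡ adj v u) → (∀ u → adj u u ≡ false)
    → (ω : Rel d → Fin d → Fin d)
    → (∀ ρ → T (isAcyclicOrientation adj ρ) → IsNaturalLabeling ρ (ω ρ))
    → (Σ (List Poly) λ P → Σ Poly λ D → IsChiTilde adj P D)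
    × (∀ P D → IsChiTilde adj P D → LeadingCoeffIs P D (numerator adj ω) (qfact d))
corollary11 d adj symmetric loopless ω natural = chiTilde-exists , chiTilde-leadingCoeff
  where open ChiTilde adj symmetric loopless ω natural
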